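{- Let $d(x)\in\mathbb{Z}[x]$ be a monic, quartic, square-free polynomial which is Pellian over $\mathbb{Z}[x]$, write $d(x)=x^4+a_3x^3+a_2x^2+a_1x+a_0$, and let $d_c(x):=d\!\left(x-\frac{a_3}{4}\right)$. If $f_1(x),g_1(x)\in\mathbb{Q}[x]$, $g_1\neq 0$, is a solution of $f_1(x)^2-d_c(x)g_1(x)^2=1$ with $\deg f_1$ minimal among all such nontrivial solutions over $\mathbb{Q}[x]$, then the leading coefficient of $f_1(x)$ is an integer.
   Context: A non-square $d(x)\in\mathbb{Z}[x]$ is Pellian over $\mathbb{Z}[x]$ if there exist $f(x),g(x)\in\mathbb{Z}[x]$ with $g\neq 0$ and $f(x)^2-d(x)g(x)^2=1$. -}

module Defs where

open import Data.Nat as ℕ using (ℕ; zero; suc; _≤_; _<_)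
open import Data.Integer as ℤ using (ℤ)
open import Data.Rational as ℚ using (ℚ)
open import Data.List using (List; []; _∷_; map)
open import Data.Product using (Σ; ∃; _×_; _,_)
open import Relation.Nullary using (¬_)
open import Relation.Binary.PropositionalEquality using (_≡_; _≢_)

-- Univariate polynomials over a (raw) commutative ring A, represented as
-- coefficient lists, lowest degree first.  Equality of polynomials is
-- coefficientwise equality (so trailing zeros are irrelevant).
module Poly {A : Set} (0# 1# : A) (_⊕_ _⊗_ : A → A → A) (⊖_ : A → A) where

  Pol : Set
  Pol = List A

  coeff : Pol → ℕ → A
  coeff []      _       = 0#
  coeff (a ∷ p) zero    = a
  coeff (a ∷ p) (suc n) = coeff p n

  infixl 6 _+ₚ_ _-ₚ_
  infixl 7 _*ₚ_
  infix 4 _≈ₚ_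

  _+ₚ_ : Pol → Pol → Pol
  []      +ₚ q       = q
  (a ∷ p) +ₚ []      = a ∷ p
  (a ∷ p) +ₚ (b ∷ q) = (a ⊕ b) ∷ (p +ₚ q)

  negₚ : Pol → Pol
  negₚ = map ⊖_

  _-ₚ_ : Pol → Pol → Pol
  p -ₚ q = p +ₚ negₚ q

  _*ₚ_ : Pol → Pol → Pol
  []      *ₚ q = []
  (a ∷ p) *ₚ q = map (a ⊗_) q +ₚ (0# ∷ (p *ₚ q))

  compose : Pol → Pol → Pol
  compose []      q = []
  compose (a ∷ p) q = (a ∷ []) +ₚ (q *ₚ compose p q)

  oneₚ : Pol
  oneₚ = 1# ∷ []

  _≈ₚ_ : Pol → Pol → Set
  p ≈ₚ q = ∀ n → coeff p n ≡ coeff q n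

  IsZero : Pol → Set
  IsZero p = ∀ n → coeff p n ≡ 0#

  HasDegree : Pol → ℕ → Set
  HasDegree p n = (coeff p n ≢ 0#) × (∀ m → n < m → coeff p m ≡ 0#)

  PellSol : Pol → Pol → Pol → Set
  PellSol d f g = f *ₚ f -ₚ d *ₚ (g *ₚ g) ≈ₚ oneₚ

module ℤ[x] = Poly (ℤ.+ 0) (ℤ.+ 1) ℤ._+_ ℤ._*_ ℤ.-_
module ℚ[x] = Poly ℚ.0ℚ ℚ.1ℚ ℚ._+_ ℚ._*_ ℚ.-_

ℤPoly : Set
ℤPoly = ℤ[x].Pol

ℚPoly : Set
ℚPoly = ℚ[x].Pol

ι : ℤ → ℚ
ι z = z ℚ./ 1

toℚ[x] : ℤPoly → ℚPoly
toℚ[x] = map ι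

quartic : ℤ → ℤ → ℤ → ℤ → ℤPoly
quartic a₃ a₂ a₁ a₀ = a₀ ∷ a₁ ∷ a₂ ∷ a₃ ∷ ℤ.+ 1 ∷ []

SquareFree : ℤPoly → Set
SquareFree d = ∀ h k → ℤ[x]._≈ₚ_ (ℤ[x]._*ₚ_ (ℤ[x]._*ₚ_ h h) k) d
             → ∀ n → 1 ≤ n → ℤ[x].coeff h n ≡ ℤ.+ 0

IsSquare : ℤPoly → Set
IsSquare d = ∃ λ h → ℤ[x]._≈ₚ_ (ℤ[x]._*ₚ_ h h) d

Pellian : ℤPoly → Set
Pellian d = (¬ IsSquare d) × (∃ λ f → ∃ λ g → (¬ ℤ[x].IsZero g) × ℤ[x].PellSol d f g)

centered : ℤ → ℤ → ℤ → ℤ → ℚPoly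
centered a₃ a₂ a₁ a₀ =
  ℚ[x].compose (toℚ[x] (quartic a₃ a₂ a₁ a₀)) (ℚ.- (a₃ ℚ./ 4) ∷ ℚ.1ℚ ∷ [])

-- Composing the minimal solution (f, g) of F² − D G² = 1 over ℚ[x] with another nontrivial solution
-- (F, G) gives the solutions F f ∓ D G g, whose product is f² + D G² and whose sum is 2 F f. Comparing
-- degrees, one of them has degree |deg F − deg f| and leading coefficient lc(f² + D G²) / (2 lc F lc f).
-- Minimality of deg f rules out deg F < deg f, makes that solution a constant ±1 when deg F = deg f
-- (so lc(F)² = c² for c = lc f), and otherwise gives lc F = 2 e c with e the leading coefficient of a
-- solution of smaller degree. By induction lc(F)² = 4ᵏ c²⁽ᵏ⁺¹⁾ for every nontrivial solution. The
-- integral solution of the Pellian quartic d, composed with x − a₃/4 (which keeps leading coefficients),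
-- is such a solution with lc F ∈ ℤ; so the denominator q of c satisfies q²⁽ᵏ⁺¹⁾ ∣ 4ᵏ, forcing q = 1.

module Submission where

open import Algebra.Bundles using (CommutativeRing; CommutativeSemigroup)
open import Algebra.Core using (Op₁; Op₂)
open import Algebra.Structures using (IsCommutativeRing)
import Algebra.Properties.CommutativeSemigroup as CommutativeSemigroupProperties
import Algebra.Properties.Ring as RingProperties
import Algebra.Solver.Ring as RingSolver
open import Algebra.Solver.Ring.AlmostCommutativeRing using (fromCommutativeRing; _-Raw-AlmostCommutative⟶_)
open import Data.Empty using (⊥; ⊥-elim)
open import Data.Integer as ℤ using (ℤ)
import Data.Integer.Properties as ℤP
open import Data.List using ([]; _∷_; map)
open import Data.Maybe using (Maybe; just; nothing)
open import Data.Nat as ℕ using (ℕ; zero; suc; _<_; _≤_; z≤n; s≤s)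
open import Data.Nat.Coprimality as Coprime using (Coprime; coprime-divisor)
open import Data.Nat.Divisibility using (_∣_; divides; ∣-trans; ∣⇒≤; ∣1⇒≡1)
open import Data.Nat.Induction using (<-rec)
import Data.Nat.Properties as ℕP
open import Data.Product using (_,_; _×_; ∃; ∃₂; proj₁; proj₂)
open import Data.Rational as ℚ using (ℚ; 0ℚ; 1ℚ; toℚᵘ)
import Data.Rational.Properties as ℚP
open import Data.Rational.Solver using (module +-*-Solver)
open import Data.Rational.Unnormalised as ℚᵘ using (mkℚᵘ; *≡*)
import Data.Rational.Unnormalised.Properties as ℚᵘP
open import Data.Sum using (_⊎_; inj₁; inj₂; [_,_]′; fromInj₂)
open import Function using (_∘_)
open import Level using (0ℓ)
open import Relation.Binary.Definitions using (DecidableEquality; Tri; tri<; tri≈; tri>)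
open import Relation.Binary.PropositionalEquality
import Relation.Binary.Reasoning.Setoid as SetoidReasoning
open import Relation.Nullary using (¬_; yes; no)

open import Algebra.Properties.CommutativeSemiring.Exp (CommutativeRing.commutativeSemiring ℚP.+-*-commutativeRing)
  using (_^_; ^-distrib-*; ^-homo-*)

open import Defs

open CommutativeSemigroupProperties ℕP.+-commutativeSemigroup using () renaming (interchange to ℕ-+-interchange)

m+m≡n+n⇒m≡n : ∀ {m n} → m ℕ.+ m ≡ n ℕ.+ n → m ≡ n
m+m≡n+n⇒m≡n {m} {n} e with ℕP.<-cmp m n
... | tri< m<n _ _ = ⊥-elim (ℕP.<-irrefl e (ℕP.+-mono-< m<n m<n))
... | tri≈ _ m≡n _ = m≡n
... | tri> _ _ n<m = ⊥-elim (ℕP.<-irrefl (sym e) (ℕP.+-mono-< n<m n<m))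

m+[n+o]≡o+o⇒m+n≡o : ∀ m n o → m ℕ.+ (n ℕ.+ o) ≡ o ℕ.+ o → m ℕ.+ n ≡ o
m+[n+o]≡o+o⇒m+n≡o m n o e = ℕP.+-cancelʳ-≡ o (m ℕ.+ n) o (trans (ℕP.+-assoc m n o) e)

m+[n+o]≡n+n⇒m+o≡n : ∀ m n o → m ℕ.+ (n ℕ.+ o) ≡ n ℕ.+ n → m ℕ.+ o ≡ n
m+[n+o]≡n+n⇒m+o≡n m n o e =
  ℕP.+-cancelʳ-≡ n (m ℕ.+ o) n (trans (ℕP.+-assoc m o n) (trans (cong (m ℕ.+_) (ℕP.+-comm o n)) e))

module PolynomialRing
  {A : Set} {add mul : Op₂ A} {neg : Op₁ A} {0ᴬ 1ᴬ : A}
  (isCommutativeRing : IsCommutativeRing _≡_ add mul neg 0ᴬ 1ᴬ) where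

  coefficientRing : CommutativeRing 0ℓ 0ℓ
  coefficientRing = record { isCommutativeRing = isCommutativeRing }

  private
    module R = CommutativeRing coefficientRing
  open R using (_+_; _*_; -_; 0#; 1#)
  open RingProperties R.ring using (-0#≈0#)
  open Poly 0# 1# _+_ _*_ -_ public

  -- A record rather than _≈ₚ_ itself, so that p and q can be inferred from a proof.
  infix 4 _≋_
  record _≋_ (p q : Pol) : Set where
    constructor mk≋
    field coeff-≡ : p ≈ₚ q
  open _≋_ public

  ≋-refl : ∀ {p} → p ≋ p
  ≋-refl = mk≋ λ _ → refl

  ≋-sym : ∀ {p q} → p ≋ q → q ≋ p
  ≋-sym (mk≋ e) = mk≋ λ n → sym (e n)

  ≋-trans : ∀ {p q r} → p ≋ q → q ≋ r → p ≋ r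
  ≋-trans (mk≋ e) (mk≋ f) = mk≋ λ n → trans (e n) (f n)

  ∷-cong : ∀ {a b p q} → a ≡ b → p ≋ q → a ∷ p ≋ b ∷ q
  ∷-cong a≡b (mk≋ e) = mk≋ λ { zero → a≡b ; (suc n) → e n }

  0∷≋ : ∀ {p} → p ≋ [] → 0# ∷ p ≋ []
  0∷≋ (mk≋ e) = mk≋ λ { zero → refl ; (suc n) → e n }

  coeff-+ₚ : ∀ p q n → coeff (p +ₚ q) n ≡ coeff p n + coeff q n
  coeff-+ₚ []      q       n       = sym (R.+-identityˡ _)
  coeff-+ₚ (a ∷ p) []      n       = sym (R.+-identityʳ _)
  coeff-+ₚ (a ∷ p) (b ∷ q) zero    = refl
  coeff-+ₚ (a ∷ p) (b ∷ q) (suc n) = coeff-+ₚ p q n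

  coeff-negₚ : ∀ p n → coeff (negₚ p) n ≡ - coeff p n
  coeff-negₚ []      n       = sym -0#≈0#
  coeff-negₚ (a ∷ p) zero    = refl
  coeff-negₚ (a ∷ p) (suc n) = coeff-negₚ p n

  coeff-scale : ∀ a q n → coeff (map (a *_) q) n ≡ a * coeff q n
  coeff-scale a []      n       = sym (R.zeroʳ a)
  coeff-scale a (b ∷ q) zero    = refl
  coeff-scale a (b ∷ q) (suc n) = coeff-scale a q n

  +ₚ-cong : ∀ {p p′ q q′} → p ≋ p′ → q ≋ q′ → p +ₚ q ≋ p′ +ₚ q′
  +ₚ-cong {p} {p′} {q} {q′} (mk≋ e) (mk≋ f) = mk≋ λ n → begin
    coeff (p +ₚ q) n          ≡⟨ coeff-+ₚ p q n ⟩
    coeff p n + coeff q n     ≡⟨ cong₂ _+_ (e n) (f n) ⟩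
    coeff p′ n + coeff q′ n   ≡⟨ coeff-+ₚ p′ q′ n ⟨
    coeff (p′ +ₚ q′) n        ∎
    where open ≡-Reasoning

  negₚ-cong : ∀ {p q} → p ≋ q → negₚ p ≋ negₚ q
  negₚ-cong {p} {q} (mk≋ e) = mk≋ λ n →
    trans (coeff-negₚ p n) (trans (cong -_ (e n)) (sym (coeff-negₚ q n)))

  scale-cong : ∀ {a b p q} → a ≡ b → p ≋ q → map (a *_) p ≋ map (b *_) q
  scale-cong {a} {b} {p} {q} refl (mk≋ e) = mk≋ λ n →
    trans (coeff-scale a p n) (trans (cong (a *_) (e n)) (sym (coeff-scale a q n)))

  +ₚ-assoc : ∀ p q r → (p +ₚ q) +ₚ r ≋ p +ₚ (q +ₚ r)
  +ₚ-assoc p q r = mk≋ λ n → begin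
    coeff ((p +ₚ q) +ₚ r) n                ≡⟨ coeff-+ₚ (p +ₚ q) r n ⟩
    coeff (p +ₚ q) n + coeff r n           ≡⟨ cong (_+ coeff r n) (coeff-+ₚ p q n) ⟩
    coeff p n + coeff q n + coeff r n      ≡⟨ R.+-assoc (coeff p n) _ _ ⟩
    coeff p n + (coeff q n + coeff r n)    ≡⟨ cong (coeff p n +_) (coeff-+ₚ q r n) ⟨
    coeff p n + coeff (q +ₚ r) n           ≡⟨ coeff-+ₚ p (q +ₚ r) n ⟨
    coeff (p +ₚ (q +ₚ r)) n                ∎
    where open ≡-Reasoning

  +ₚ-comm : ∀ p q → p +ₚ q ≋ q +ₚ p
  +ₚ-comm p q = mk≋ λ n →
    trans (coeff-+ₚ p q n) (trans (R.+-comm (coeff p n) _) (sym (coeff-+ₚ q p n)))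

  +ₚ-identityˡ : ∀ p → [] +ₚ p ≋ p
  +ₚ-identityˡ p = ≋-refl

  +ₚ-identityʳ : ∀ p → p +ₚ [] ≋ p
  +ₚ-identityʳ p = mk≋ λ n → trans (coeff-+ₚ p [] n) (R.+-identityʳ _)

  +ₚ-inverseʳ : ∀ p → p +ₚ negₚ p ≋ []
  +ₚ-inverseʳ p = mk≋ λ n →
    trans (coeff-+ₚ p (negₚ p) n) (trans (cong (coeff p n +_) (coeff-negₚ p n)) (R.-‿inverseʳ _))

  +ₚ-inverseˡ : ∀ p → negₚ p +ₚ p ≋ []
  +ₚ-inverseˡ p = ≋-trans (+ₚ-comm (negₚ p) p) (+ₚ-inverseʳ p)

  +ₚ-commutativeSemigroup : CommutativeSemigroup 0ℓ 0ℓ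
  +ₚ-commutativeSemigroup = record
    { Carrier = Pol ; _≈_ = _≋_ ; _∙_ = _+ₚ_
    ; isCommutativeSemigroup = record
      { isSemigroup = record
        { isMagma = record
          { isEquivalence = record { refl = ≋-refl ; sym = ≋-sym ; trans = ≋-trans }
          ; ∙-cong = +ₚ-cong }
        ; assoc = +ₚ-assoc }
      ; comm = +ₚ-comm } }

  open CommutativeSemigroupProperties +ₚ-commutativeSemigroup using (interchange; x∙yz≈y∙xz)

  scale-+ₚ : ∀ a p q → map (a *_) (p +ₚ q) ≋ map (a *_) p +ₚ map (a *_) q
  scale-+ₚ a p q = mk≋ λ n → begin
    coeff (map (a *_) (p +ₚ q)) n                 ≡⟨ coeff-scale a (p +ₚ q) n ⟩
    a * coeff (p +ₚ q) n                          ≡⟨ cong (a *_) (coeff-+ₚ p q n) ⟩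
    a * (coeff p n + coeff q n)                   ≡⟨ R.distribˡ a (coeff p n) (coeff q n) ⟩
    a * coeff p n + a * coeff q n                 ≡⟨ cong₂ _+_ (coeff-scale a p n) (coeff-scale a q n) ⟨
    coeff (map (a *_) p) n + coeff (map (a *_) q) n ≡⟨ coeff-+ₚ (map (a *_) p) _ n ⟨
    coeff (map (a *_) p +ₚ map (a *_) q) n        ∎
    where open ≡-Reasoning

  +-scale : ∀ a b p → map ((a + b) *_) p ≋ map (a *_) p +ₚ map (b *_) p
  +-scale a b p = mk≋ λ n → begin
    coeff (map ((a + b) *_) p) n                  ≡⟨ coeff-scale (a + b) p n ⟩
    (a + b) * coeff p n                           ≡⟨ R.distribʳ (coeff p n) a b ⟩
    a * coeff p n + b * coeff p n                 ≡⟨ cong₂ _+_ (coeff-scale a p n) (coeff-scale b p n) ⟨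
    coeff (map (a *_) p) n + coeff (map (b *_) p) n ≡⟨ coeff-+ₚ (map (a *_) p) _ n ⟨
    coeff (map (a *_) p +ₚ map (b *_) p) n        ∎
    where open ≡-Reasoning

  *-scale : ∀ a b p → map ((a * b) *_) p ≋ map (a *_) (map (b *_) p)
  *-scale a b p = mk≋ λ n → begin
    coeff (map ((a * b) *_) p) n        ≡⟨ coeff-scale (a * b) p n ⟩
    a * b * coeff p n                   ≡⟨ R.*-assoc a b (coeff p n) ⟩
    a * (b * coeff p n)                 ≡⟨ cong (a *_) (coeff-scale b p n) ⟨
    a * coeff (map (b *_) p) n          ≡⟨ coeff-scale a (map (b *_) p) n ⟨
    coeff (map (a *_) (map (b *_) p)) n ∎
    where open ≡-Reasoning

  0-scale : ∀ p → map (0# *_) p ≋ []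
  0-scale p = mk≋ λ n → trans (coeff-scale 0# p n) (R.zeroˡ (coeff p n))

  1-scale : ∀ p → map (1# *_) p ≋ p
  1-scale p = mk≋ λ n → trans (coeff-scale 1# p n) (R.*-identityˡ (coeff p n))

  0∷-*ₚ : ∀ p q → (0# ∷ p) *ₚ q ≋ 0# ∷ (p *ₚ q)
  0∷-*ₚ p q = +ₚ-cong (0-scale q) ≋-refl

  *ₚ-zeroʳ : ∀ p → p *ₚ [] ≋ []
  *ₚ-zeroʳ []      = ≋-refl
  *ₚ-zeroʳ (a ∷ p) = 0∷≋ (*ₚ-zeroʳ p)

  *ₚ-zeroˡ : ∀ {p} q → p ≋ [] → p *ₚ q ≋ []
  *ₚ-zeroˡ {[]}    q _       = ≋-refl
  *ₚ-zeroˡ {a ∷ p} q (mk≋ e) = ≋-trans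
    (+ₚ-cong (≋-trans (scale-cong (e 0) ≋-refl) (0-scale q)) (0∷≋ (*ₚ-zeroˡ {p} q (mk≋ (e ∘ suc)))))
    (+ₚ-identityʳ [])

  *ₚ-congʳ : ∀ {p p′} q → p ≋ p′ → p *ₚ q ≋ p′ *ₚ q
  *ₚ-congʳ {[]}    {p′}     q e       = ≋-sym (*ₚ-zeroˡ q (≋-sym e))
  *ₚ-congʳ {a ∷ p} {[]}     q e       = *ₚ-zeroˡ q e
  *ₚ-congʳ {a ∷ p} {b ∷ p′} q (mk≋ e) =
    +ₚ-cong (scale-cong (e 0) ≋-refl) (∷-cong refl (*ₚ-congʳ {p} {p′} q (mk≋ (e ∘ suc))))

  *ₚ-congˡ : ∀ p {q q′} → q ≋ q′ → p *ₚ q ≋ p *ₚ q′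
  *ₚ-congˡ []      e = ≋-refl
  *ₚ-congˡ (a ∷ p) e = +ₚ-cong (scale-cong refl e) (∷-cong refl (*ₚ-congˡ p e))

  *ₚ-cong : ∀ {p p′ q q′} → p ≋ p′ → q ≋ q′ → p *ₚ q ≋ p′ *ₚ q′
  *ₚ-cong {p′ = p′} {q} e f = ≋-trans (*ₚ-congʳ q e) (*ₚ-congˡ p′ f)

  0∷-+ₚ : ∀ p q → 0# ∷ (p +ₚ q) ≋ (0# ∷ p) +ₚ (0# ∷ q)
  0∷-+ₚ p q = ∷-cong (sym (R.+-identityʳ 0#)) ≋-refl

  *ₚ-distribˡ : ∀ p q r → p *ₚ (q +ₚ r) ≋ p *ₚ q +ₚ p *ₚ r
  *ₚ-distribˡ []      q r = ≋-refl
  *ₚ-distribˡ (a ∷ p) q r = ≋-trans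
    (+ₚ-cong (scale-+ₚ a q r) (≋-trans (∷-cong refl (*ₚ-distribˡ p q r)) (0∷-+ₚ (p *ₚ q) (p *ₚ r))))
    (interchange (map (a *_) q) (map (a *_) r) (0# ∷ (p *ₚ q)) (0# ∷ (p *ₚ r)))

  *ₚ-distribʳ : ∀ r p q → (p +ₚ q) *ₚ r ≋ p *ₚ r +ₚ q *ₚ r
  *ₚ-distribʳ r []      q       = ≋-refl
  *ₚ-distribʳ r (a ∷ p) []      = ≋-sym (+ₚ-identityʳ _)
  *ₚ-distribʳ r (a ∷ p) (b ∷ q) = ≋-trans
    (+ₚ-cong (+-scale a b r) (≋-trans (∷-cong refl (*ₚ-distribʳ r p q)) (0∷-+ₚ (p *ₚ r) (q *ₚ r))))
    (interchange (map (a *_) r) (map (b *_) r) (0# ∷ (p *ₚ r)) (0# ∷ (q *ₚ r)))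

  *ₚ-identityˡ : ∀ p → oneₚ *ₚ p ≋ p
  *ₚ-identityˡ p = ≋-trans (+ₚ-cong (1-scale p) (0∷≋ ≋-refl)) (+ₚ-identityʳ p)

  *ₚ-∷ : ∀ p b q → p *ₚ (b ∷ q) ≋ map (b *_) p +ₚ (0# ∷ (p *ₚ q))
  *ₚ-∷ []      b q = ≋-sym (0∷≋ ≋-refl)
  *ₚ-∷ (a ∷ p) b q = ∷-cong
    (trans (R.+-identityʳ _) (trans (R.*-comm a b) (sym (R.+-identityʳ _))))
    (≋-trans (+ₚ-cong ≋-refl (*ₚ-∷ p b q)) (x∙yz≈y∙xz (map (a *_) q) (map (b *_) p) (0# ∷ (p *ₚ q))))

  *ₚ-comm : ∀ p q → p *ₚ q ≋ q *ₚ p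
  *ₚ-comm []      q = ≋-sym (*ₚ-zeroʳ q)
  *ₚ-comm (a ∷ p) q = ≋-trans (+ₚ-cong ≋-refl (∷-cong refl (*ₚ-comm p q))) (≋-sym (*ₚ-∷ q a p))

  *ₚ-identityʳ : ∀ p → p *ₚ oneₚ ≋ p
  *ₚ-identityʳ p = ≋-trans (*ₚ-comm p oneₚ) (*ₚ-identityˡ p)

  scale-*ₚ : ∀ a p q → map (a *_) p *ₚ q ≋ map (a *_) (p *ₚ q)
  scale-*ₚ a []      q = ≋-refl
  scale-*ₚ a (b ∷ p) q = ≋-trans
    (+ₚ-cong (*-scale a b q) (∷-cong refl (scale-*ₚ a p q)))
    (≋-sym (≋-trans (scale-+ₚ a (map (b *_) q) (0# ∷ (p *ₚ q))) (+ₚ-cong ≋-refl (∷-cong (R.zeroʳ a) ≋-refl))))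

  *ₚ-assoc : ∀ p q r → (p *ₚ q) *ₚ r ≋ p *ₚ (q *ₚ r)
  *ₚ-assoc []      q r = ≋-refl
  *ₚ-assoc (a ∷ p) q r = ≋-trans (*ₚ-distribʳ r (map (a *_) q) (0# ∷ (p *ₚ q)))
    (+ₚ-cong (scale-*ₚ a q r) (≋-trans (0∷-*ₚ (p *ₚ q) r) (∷-cong refl (*ₚ-assoc p q r))))

  commutativeRing : CommutativeRing 0ℓ 0ℓ
  commutativeRing = record
    { Carrier = Pol ; _≈_ = _≋_ ; _+_ = _+ₚ_ ; _*_ = _*ₚ_ ; -_ = negₚ ; 0# = [] ; 1# = oneₚ
    ; isCommutativeRing = record
      { isRing = record
        { +-isAbelianGroup = record
          { isGroup = record
            { isMonoid = record
              { isSemigroup = CommutativeSemigroup.isSemigroup +ₚ-commutativeSemigroup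
              ; identity = +ₚ-identityˡ , +ₚ-identityʳ }
            ; inverse = +ₚ-inverseˡ , +ₚ-inverseʳ
            ; ⁻¹-cong = negₚ-cong }
          ; comm = +ₚ-comm }
        ; *-cong = *ₚ-cong
        ; *-assoc = *ₚ-assoc
        ; *-identity = *ₚ-identityˡ , *ₚ-identityʳ
        ; distrib = *ₚ-distribˡ , *ₚ-distribʳ }
      ; *-comm = *ₚ-comm } }

  private
    module P = CommutativeRing commutativeRing
  open RingProperties P.ring using (-‿distribʳ-*; -‿+-comm)
  open CommutativeSemigroupProperties P.*-commutativeSemigroup using () renaming (x∙yz≈y∙xz to *ₚ-leftComm)

  [_]ₚ : A → Pol
  [ a ]ₚ = a ∷ []

  compose-zero : ∀ {p} q → p ≋ [] → compose p q ≋ []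
  compose-zero {[]}    q _       = ≋-refl
  compose-zero {a ∷ p} q (mk≋ e) = ≋-trans
    (+ₚ-cong (∷-cong (e 0) ≋-refl) (≋-trans (*ₚ-congˡ q (compose-zero {p} q (mk≋ (e ∘ suc)))) (*ₚ-zeroʳ q)))
    (0∷≋ ≋-refl)

  compose-cong : ∀ {p p′} q → p ≋ p′ → compose p q ≋ compose p′ q
  compose-cong {[]}    {p′}     q e       = ≋-sym (compose-zero q (≋-sym e))
  compose-cong {a ∷ p} {[]}     q e       = compose-zero q e
  compose-cong {a ∷ p} {b ∷ p′} q (mk≋ e) =
    +ₚ-cong (∷-cong (e 0) ≋-refl) (*ₚ-congˡ q (compose-cong {p} {p′} q (mk≋ (e ∘ suc))))

  compose-+ₚ : ∀ p r q → compose (p +ₚ r) q ≋ compose p q +ₚ compose r q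
  compose-+ₚ []      r       q = ≋-refl
  compose-+ₚ (a ∷ p) []      q = ≋-sym (+ₚ-identityʳ _)
  compose-+ₚ (a ∷ p) (b ∷ r) q = begin
    [ a + b ]ₚ +ₚ q *ₚ compose (p +ₚ r) q                  ≈⟨ +ₚ-cong ≋-refl (*ₚ-congˡ q (compose-+ₚ p r q)) ⟩
    ([ a ]ₚ +ₚ [ b ]ₚ) +ₚ q *ₚ (compose p q +ₚ compose r q) ≈⟨ +ₚ-cong ≋-refl (*ₚ-distribˡ q _ _) ⟩
    ([ a ]ₚ +ₚ [ b ]ₚ) +ₚ (q *ₚ compose p q +ₚ q *ₚ compose r q)
      ≈⟨ interchange [ a ]ₚ [ b ]ₚ (q *ₚ compose p q) (q *ₚ compose r q) ⟩
    ([ a ]ₚ +ₚ q *ₚ compose p q) +ₚ ([ b ]ₚ +ₚ q *ₚ compose r q) ∎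
    where open SetoidReasoning P.setoid

  compose-negₚ : ∀ p q → compose (negₚ p) q ≋ negₚ (compose p q)
  compose-negₚ []      q = ≋-refl
  compose-negₚ (a ∷ p) q = begin
    negₚ [ a ]ₚ +ₚ q *ₚ compose (negₚ p) q  ≈⟨ +ₚ-cong ≋-refl (*ₚ-congˡ q (compose-negₚ p q)) ⟩
    negₚ [ a ]ₚ +ₚ q *ₚ negₚ (compose p q)  ≈⟨ +ₚ-cong ≋-refl (-‿distribʳ-* q (compose p q)) ⟨
    negₚ [ a ]ₚ +ₚ negₚ (q *ₚ compose p q)  ≈⟨ -‿+-comm [ a ]ₚ (q *ₚ compose p q) ⟩
    negₚ ([ a ]ₚ +ₚ q *ₚ compose p q)       ∎
    where open SetoidReasoning P.setoid

  [_]ₚ-*ₚ-[_]ₚ : ∀ a b → [ a ]ₚ *ₚ [ b ]ₚ ≋ [ a * b ]ₚ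
  [ a ]ₚ-*ₚ-[ b ]ₚ = ∷-cong (R.+-identityʳ (a * b)) ≋-refl

  compose-scale : ∀ a r q → compose (map (a *_) r) q ≋ [ a ]ₚ *ₚ compose r q
  compose-scale a []      q = ≋-sym (*ₚ-zeroʳ [ a ]ₚ)
  compose-scale a (b ∷ r) q = begin
    [ a * b ]ₚ +ₚ q *ₚ compose (map (a *_) r) q       ≈⟨ +ₚ-cong ≋-refl (*ₚ-congˡ q (compose-scale a r q)) ⟩
    [ a * b ]ₚ +ₚ q *ₚ ([ a ]ₚ *ₚ compose r q)         ≈⟨ +ₚ-cong (≋-sym [ a ]ₚ-*ₚ-[ b ]ₚ) (*ₚ-leftComm q [ a ]ₚ _) ⟩
    [ a ]ₚ *ₚ [ b ]ₚ +ₚ [ a ]ₚ *ₚ (q *ₚ compose r q)   ≈⟨ *ₚ-distribˡ [ a ]ₚ [ b ]ₚ (q *ₚ compose r q) ⟨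
    [ a ]ₚ *ₚ ([ b ]ₚ +ₚ q *ₚ compose r q)             ∎
    where open SetoidReasoning P.setoid

  compose-0∷ : ∀ p q → compose (0# ∷ p) q ≋ q *ₚ compose p q
  compose-0∷ p q = +ₚ-cong (0∷≋ ≋-refl) ≋-refl

  compose-*ₚ : ∀ p r q → compose (p *ₚ r) q ≋ compose p q *ₚ compose r q
  compose-*ₚ []      r q = ≋-refl
  compose-*ₚ (a ∷ p) r q = begin
    compose (map (a *_) r +ₚ (0# ∷ (p *ₚ r))) q                       ≈⟨ compose-+ₚ (map (a *_) r) _ q ⟩
    compose (map (a *_) r) q +ₚ compose (0# ∷ (p *ₚ r)) q             ≈⟨ +ₚ-cong (compose-scale a r q) (compose-0∷ (p *ₚ r) q) ⟩
    [ a ]ₚ *ₚ compose r q +ₚ q *ₚ compose (p *ₚ r) q                  ≈⟨ +ₚ-cong ≋-refl (*ₚ-congˡ q (compose-*ₚ p r q)) ⟩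
    [ a ]ₚ *ₚ compose r q +ₚ q *ₚ (compose p q *ₚ compose r q)        ≈⟨ +ₚ-cong ≋-refl (*ₚ-assoc q _ _) ⟨
    [ a ]ₚ *ₚ compose r q +ₚ q *ₚ compose p q *ₚ compose r q          ≈⟨ *ₚ-distribʳ (compose r q) [ a ]ₚ (q *ₚ compose p q) ⟨
    ([ a ]ₚ +ₚ q *ₚ compose p q) *ₚ compose r q                        ∎
    where open SetoidReasoning P.setoid

  compose-oneₚ : ∀ q → compose oneₚ q ≋ oneₚ
  compose-oneₚ q = ≋-trans (+ₚ-cong ≋-refl (*ₚ-zeroʳ q)) (+ₚ-identityʳ oneₚ)

  record Pell (D F G : Pol) : Set where
    constructor mkPell
    field pell : F *ₚ F -ₚ D *ₚ (G *ₚ G) ≋ oneₚ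

  Pell-compose : ∀ {D F G} q → Pell D F G → Pell (compose D q) (compose F q) (compose G q)
  Pell-compose {D} {F} {G} q (mkPell e) = mkPell (begin
    F′ *ₚ F′ -ₚ D′ *ₚ (G′ *ₚ G′)
      ≈⟨ +ₚ-cong (compose-*ₚ F F q) (negₚ-cong (*ₚ-congˡ D′ (compose-*ₚ G G q))) ⟨
    compose (F *ₚ F) q -ₚ D′ *ₚ compose (G *ₚ G) q
      ≈⟨ +ₚ-cong ≋-refl (negₚ-cong (compose-*ₚ D (G *ₚ G) q)) ⟨
    compose (F *ₚ F) q -ₚ compose (D *ₚ (G *ₚ G)) q
      ≈⟨ +ₚ-cong ≋-refl (compose-negₚ (D *ₚ (G *ₚ G)) q) ⟨
    compose (F *ₚ F) q +ₚ compose (negₚ (D *ₚ (G *ₚ G))) q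
      ≈⟨ compose-+ₚ (F *ₚ F) _ q ⟨
    compose (F *ₚ F -ₚ D *ₚ (G *ₚ G)) q
      ≈⟨ compose-cong q e ⟩
    compose oneₚ q
      ≈⟨ compose-oneₚ q ⟩
    oneₚ ∎)
    where
      open SetoidReasoning P.setoid
      F′ = compose F q
      G′ = compose G q
      D′ = compose D q

  Pell-square : ∀ {D F G} → Pell D F G → F *ₚ F ≋ oneₚ +ₚ D *ₚ (G *ₚ G)
  Pell-square {D} {F} {G} (mkPell e) = begin
    F *ₚ F                                             ≈⟨ +ₚ-identityʳ (F *ₚ F) ⟨
    F *ₚ F +ₚ []                                       ≈⟨ +ₚ-cong ≋-refl (+ₚ-inverseˡ (D *ₚ (G *ₚ G))) ⟨
    F *ₚ F +ₚ (negₚ (D *ₚ (G *ₚ G)) +ₚ D *ₚ (G *ₚ G)) ≈⟨ +ₚ-assoc (F *ₚ F) _ _ ⟨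
    F *ₚ F -ₚ D *ₚ (G *ₚ G) +ₚ D *ₚ (G *ₚ G)          ≈⟨ +ₚ-cong e ≋-refl ⟩
    oneₚ +ₚ D *ₚ (G *ₚ G)                              ∎
    where open SetoidReasoning P.setoid

  Pell-trivial : ∀ {D F G} → Pell D F G → G ≋ [] → F *ₚ F ≋ oneₚ
  Pell-trivial {D} {F} {G} pell G≋0 = ≋-trans (Pell-square pell)
    (≋-trans (+ₚ-cong ≋-refl (≋-trans (*ₚ-congˡ D (*ₚ-zeroˡ G G≋0)) (*ₚ-zeroʳ D))) (+ₚ-identityʳ oneₚ))


module PolynomialDegree
  {A : Set} {add mul : Op₂ A} {neg : Op₁ A} {0ᴬ 1ᴬ : A}
  (isCommutativeRing : IsCommutativeRing _≡_ add mul neg 0ᴬ 1ᴬ)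
  (_≟_ : DecidableEquality A)
  (1≢0 : 1ᴬ ≢ 0ᴬ)
  (*-nonZero : ∀ {x y} → x ≢ 0ᴬ → y ≢ 0ᴬ → mul x y ≢ 0ᴬ) where

  open PolynomialRing isCommutativeRing
  private
    module R = CommutativeRing coefficientRing
  open R using (_+_; _*_; 0#; 1#)

  record Degree≤ (p : Pol) (n : ℕ) : Set where
    constructor mkDegree≤
    field vanishes : ∀ m → n < m → coeff p m ≡ 0#
  open Degree≤ public

  record Degree (p : Pol) (n : ℕ) : Set where
    constructor mkDegree
    field
      leading≢0 : coeff p n ≢ 0#
      degree≤   : Degree≤ p n
  open Degree public

  HasDegree⇒Degree : ∀ {p n} → HasDegree p n → Degree p n
  HasDegree⇒Degree (lc≢0 , vanish) = mkDegree lc≢0 (mkDegree≤ vanish)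

  Degree⇒HasDegree : ∀ {p n} → Degree p n → HasDegree p n
  Degree⇒HasDegree (mkDegree lc≢0 (mkDegree≤ vanish)) = lc≢0 , vanish

  Degree≤-mono : ∀ {p m n} → Degree≤ p m → m ≤ n → Degree≤ p n
  Degree≤-mono (mkDegree≤ v) m≤n = mkDegree≤ λ k n<k → v k (ℕP.≤-<-trans m≤n n<k)

  Degree≤-resp-≋ : ∀ {p q n} → p ≋ q → Degree≤ p n → Degree≤ q n
  Degree≤-resp-≋ (mk≋ e) (mkDegree≤ v) = mkDegree≤ λ k n<k → trans (sym (e k)) (v k n<k)

  Degree-resp-≋ : ∀ {p q n} → p ≋ q → Degree p n → Degree q n
  Degree-resp-≋ p≋q@(mk≋ e) (mkDegree lc≢0 d) =
    mkDegree (λ lc≡0 → lc≢0 (trans (e _) lc≡0)) (Degree≤-resp-≋ p≋q d)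

  Degree-unique : ∀ {p m n} → Degree p m → Degree p n → m ≡ n
  Degree-unique {m = m} {n} (mkDegree lc≢0 (mkDegree≤ v)) (mkDegree lc≢0′ (mkDegree≤ v′))
    with ℕP.<-cmp m n
  ... | tri< m<n _ _ = ⊥-elim (lc≢0′ (v n m<n))
  ... | tri≈ _ m≡n _ = m≡n
  ... | tri> _ _ n<m = ⊥-elim (lc≢0 (v′ m n<m))

  Degree⇒≤ : ∀ {p m n} → Degree p m → Degree≤ p n → m ≤ n
  Degree⇒≤ {m = m} {n} (mkDegree lc≢0 _) (mkDegree≤ v) with ℕP.≤-<-connex m n
  ... | inj₁ m≤n = m≤n
  ... | inj₂ n<m = ⊥-elim (lc≢0 (v m n<m))

  Degree⇒≉[] : ∀ {p n} → Degree p n → ¬ p ≋ []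
  Degree⇒≉[] (mkDegree lc≢0 _) (mk≋ e) = lc≢0 (e _)

  []-Degree≤ : ∀ {n} → Degree≤ [] n
  []-Degree≤ = mkDegree≤ λ _ _ → refl

  Degree≤-∷ : ∀ {a p n} → Degree≤ p n → Degree≤ (a ∷ p) (suc n)
  Degree≤-∷ (mkDegree≤ v) = mkDegree≤ λ { (suc k) (s≤s n<k) → v k n<k }

  [_]ₚ-Degree≤ : ∀ a → Degree≤ [ a ]ₚ 0
  [ a ]ₚ-Degree≤ = mkDegree≤ λ { (suc k) _ → refl }

  ≋[]⊎Degree : ∀ p → p ≋ [] ⊎ ∃ (Degree p)
  ≋[]⊎Degree [] = inj₁ ≋-refl
  ≋[]⊎Degree (a ∷ p) with ≋[]⊎Degree p
  ... | inj₂ (n , mkDegree lc≢0 dp) = inj₂ (suc n , mkDegree lc≢0 (Degree≤-∷ dp))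
  ... | inj₁ p≋[] with a ≟ 0#
  ...   | yes a≡0 = inj₁ (≋-trans (∷-cong a≡0 p≋[]) (0∷≋ ≋-refl))
  ...   | no  a≢0 = inj₂ (0 , mkDegree a≢0 (mkDegree≤ λ { (suc k) _ → coeff-≡ p≋[] k }))

  ≉[]⇒Degree : ∀ {p} → ¬ p ≋ [] → ∃ (Degree p)
  ≉[]⇒Degree {p} p≉0 = fromInj₂ (⊥-elim ∘ p≉0) (≋[]⊎Degree p)

  Degree≤-tail : ∀ {a p n} → Degree≤ (a ∷ p) (suc n) → Degree≤ p n
  Degree≤-tail (mkDegree≤ v) = mkDegree≤ λ k n<k → v (suc k) (s≤s n<k)

  Degree≤0⇒tail≋[] : ∀ {a p} → Degree≤ (a ∷ p) 0 → p ≋ []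
  Degree≤0⇒tail≋[] (mkDegree≤ v) = mk≋ λ k → v (suc k) (s≤s z≤n)

  +ₚ-Degree≤ : ∀ {p q n} → Degree≤ p n → Degree≤ q n → Degree≤ (p +ₚ q) n
  +ₚ-Degree≤ {p} {q} (mkDegree≤ v) (mkDegree≤ w) = mkDegree≤ λ k n<k →
    trans (coeff-+ₚ p q k) (trans (cong₂ _+_ (v k n<k) (w k n<k)) (R.+-identityʳ 0#))

  scale-Degree≤ : ∀ a {q n} → Degree≤ q n → Degree≤ (map (a *_) q) n
  scale-Degree≤ a {q} (mkDegree≤ v) = mkDegree≤ λ k n<k →
    trans (coeff-scale a q k) (trans (cong (a *_) (v k n<k)) (R.zeroʳ a))

  coeff-∷-*ₚ : ∀ a p q k → coeff ((a ∷ p) *ₚ q) k ≡ a * coeff q k + coeff (0# ∷ (p *ₚ q)) k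
  coeff-∷-*ₚ a p q k = trans (coeff-+ₚ (map (a *_) q) _ k) (cong (_+ _) (coeff-scale a q k))

  *ₚ-Degree≤ : ∀ {p q m n} → Degree≤ p m → Degree≤ q n → Degree≤ (p *ₚ q) (m ℕ.+ n)
  *ₚ-Degree≤ {[]}                 _  _  = []-Degree≤
  *ₚ-Degree≤ {a ∷ p} {q} {m} {n} dp dq =
    +ₚ-Degree≤ (Degree≤-mono (scale-Degree≤ a dq) (ℕP.m≤n+m n m)) (shifted m dp)
    where
      shifted : ∀ m → Degree≤ (a ∷ p) m → Degree≤ (0# ∷ (p *ₚ q)) (m ℕ.+ n)
      shifted zero    dp = Degree≤-resp-≋ (≋-sym (0∷≋ (*ₚ-zeroˡ q (Degree≤0⇒tail≋[] dp)))) []-Degree≤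
      shifted (suc m) dp = Degree≤-∷ (*ₚ-Degree≤ (Degree≤-tail dp) dq)

  coeff-*ₚ-top : ∀ {p q m n} → Degree≤ p m → Degree≤ q n →
                 coeff (p *ₚ q) (m ℕ.+ n) ≡ coeff p m * coeff q n
  coeff-*ₚ-top {[]}    {q} {m} {n} _  _  = sym (R.zeroˡ (coeff q n))
  coeff-*ₚ-top {a ∷ p} {q} {zero} {n} dp dq = begin
    coeff ((a ∷ p) *ₚ q) n                    ≡⟨ coeff-∷-*ₚ a p q n ⟩
    a * coeff q n + coeff (0# ∷ (p *ₚ q)) n   ≡⟨ cong (a * coeff q n +_) (coeff-≡ (0∷≋ (*ₚ-zeroˡ q (Degree≤0⇒tail≋[] dp))) n) ⟩
    a * coeff q n + 0#                        ≡⟨ R.+-identityʳ _ ⟩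
    a * coeff q n                             ∎
    where open ≡-Reasoning
  coeff-*ₚ-top {a ∷ p} {q} {suc m} {n} dp dq = begin
    coeff ((a ∷ p) *ₚ q) (suc (m ℕ.+ n))                  ≡⟨ coeff-∷-*ₚ a p q (suc (m ℕ.+ n)) ⟩
    a * coeff q (suc (m ℕ.+ n)) + coeff (p *ₚ q) (m ℕ.+ n) ≡⟨ cong₂ _+_ (cong (a *_) (vanishes dq _ n<1+m+n)) (coeff-*ₚ-top (Degree≤-tail dp) dq) ⟩
    a * 0# + coeff p m * coeff q n                        ≡⟨ cong (_+ coeff p m * coeff q n) (R.zeroʳ a) ⟩
    0# + coeff p m * coeff q n                            ≡⟨ R.+-identityˡ _ ⟩
    coeff p m * coeff q n                                 ∎
    where
      open ≡-Reasoning
      n<1+m+n : n < suc (m ℕ.+ n)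
      n<1+m+n = s≤s (ℕP.m≤n+m n m)

  *ₚ-Degree : ∀ {p q m n} → Degree p m → Degree q n → Degree (p *ₚ q) (m ℕ.+ n)
  *ₚ-Degree (mkDegree lp dp) (mkDegree lq dq) =
    mkDegree (λ lc≡0 → *-nonZero lp lq (trans (sym (coeff-*ₚ-top dp dq)) lc≡0)) (*ₚ-Degree≤ dp dq)

  coeff-+ₚ-lowerˡ : ∀ {p q m n} → Degree≤ p m → m < n → coeff (p +ₚ q) n ≡ coeff q n
  coeff-+ₚ-lowerˡ {p} {q} {n = n} dp m<n =
    trans (coeff-+ₚ p q n) (trans (cong (_+ coeff q n) (vanishes dp n m<n)) (R.+-identityˡ _))

  +ₚ-Degree-lowerˡ : ∀ {p q m n} → Degree≤ p m → m < n → Degree q n → Degree (p +ₚ q) n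
  +ₚ-Degree-lowerˡ dp m<n (mkDegree lq dq) = mkDegree
    (λ lc≡0 → lq (trans (sym (coeff-+ₚ-lowerˡ dp m<n)) lc≡0))
    (+ₚ-Degree≤ (Degree≤-mono dp (ℕP.<⇒≤ m<n)) dq)

  +ₚ-Degree-lowerʳ : ∀ {p q m n} → Degree≤ p m → m < n → Degree q n → Degree (q +ₚ p) n
  +ₚ-Degree-lowerʳ {p} {q} dp m<n dq = Degree-resp-≋ (+ₚ-comm p q) (+ₚ-Degree-lowerˡ dp m<n dq)

  oneₚ-Degree : Degree oneₚ 0
  oneₚ-Degree = mkDegree 1≢0 [ 1# ]ₚ-Degree≤

  private
    lowerFactorˡ : ∀ {X Y P S p s a b} → X *ₚ Y ≋ P → X +ₚ Y ≋ S → Degree P p → Degree S s →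
                   Degree X a → Degree Y b → a < b → a ℕ.+ s ≡ p × coeff X a * coeff S s ≡ coeff P p
    lowerFactorˡ {X} {Y} {P} {S} {a = a} {b} eP eS dP dS dX dY a<b
      with Degree-unique (Degree-resp-≋ eS (+ₚ-Degree-lowerˡ (degree≤ dX) a<b dY)) dS
         | Degree-unique (Degree-resp-≋ eP (*ₚ-Degree dX dY)) dP
    ... | refl | refl = refl , (begin
      coeff X a * coeff S b    ≡⟨ cong (coeff X a *_) (trans (sym (coeff-≡ eS b)) (coeff-+ₚ-lowerˡ (degree≤ dX) a<b)) ⟩
      coeff X a * coeff Y b    ≡⟨ coeff-*ₚ-top (degree≤ dX) (degree≤ dY) ⟨
      coeff (X *ₚ Y) (a ℕ.+ b) ≡⟨ coeff-≡ eP (a ℕ.+ b) ⟩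
      coeff P (a ℕ.+ b)        ∎)
      where open ≡-Reasoning

  -- Since deg P < 2 deg S, the factors X, Y of P have different degrees, and the one of larger
  -- degree determines the degree and leading coefficient of their sum S.
  lowerFactor : ∀ {X Y P S p s} → X *ₚ Y ≋ P → X +ₚ Y ≋ S → Degree P p → Degree S s → p < s ℕ.+ s →
    ∃₂ λ Z a → (Z ≡ X ⊎ Z ≡ Y) × Degree Z a × a ℕ.+ s ≡ p × coeff Z a * coeff S s ≡ coeff P p
  lowerFactor {X} {Y} eP eS dP dS p<2s with ≋[]⊎Degree X | ≋[]⊎Degree Y
  ... | inj₁ X≋0 | _ = ⊥-elim (Degree⇒≉[] dP (≋-trans (≋-sym eP) (*ₚ-zeroˡ Y X≋0)))
  ... | inj₂ _ | inj₁ Y≋0 =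
    ⊥-elim (Degree⇒≉[] dP (≋-trans (≋-sym eP) (≋-trans (*ₚ-congˡ X Y≋0) (*ₚ-zeroʳ X))))
  ... | inj₂ (a , dX) | inj₂ (b , dY) with ℕP.<-cmp a b
  ...   | tri< a<b _ _ = X , a , inj₁ refl , dX , lowerFactorˡ eP eS dP dS dX dY a<b
  ...   | tri> _ _ b<a = Y , b , inj₂ refl , dY ,
    lowerFactorˡ (≋-trans (*ₚ-comm Y X) eP) (≋-trans (+ₚ-comm Y X) eS) dP dS dY dX b<a
  ...   | tri≈ _ refl _ with Degree-unique (Degree-resp-≋ eP (*ₚ-Degree dX dY)) dP
  ...     | refl = ⊥-elim (ℕP.<-irrefl refl (ℕP.<-≤-trans p<2s (ℕP.+-mono-≤ s≤a s≤a)))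
    where
      s≤a = Degree⇒≤ dS (Degree≤-resp-≋ eS (+ₚ-Degree≤ (degree≤ dX) (degree≤ dY)))

  square≋oneₚ : ∀ {F} → F *ₚ F ≋ oneₚ → Degree F 0 × coeff F 0 * coeff F 0 ≡ 1#
  square≋oneₚ {F} F²≋1 with ≋[]⊎Degree F
  ... | inj₁ F≋0 = ⊥-elim (Degree⇒≉[] oneₚ-Degree (≋-trans (≋-sym F²≋1) (*ₚ-zeroˡ F F≋0)))
  ... | inj₂ (N , dF) with ℕP.m+n≡0⇒m≡0 N (Degree-unique (Degree-resp-≋ F²≋1 (*ₚ-Degree dF dF)) oneₚ-Degree)
  ...   | refl = dF , trans (sym (coeff-*ₚ-top (degree≤ dF) (degree≤ dF))) (coeff-≡ F²≋1 0)

  private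
    Pell-square-Degree : ∀ {D F G d M} → Degree D (suc d ℕ.+ suc d) → Pell D F G → Degree G M →
      Degree (D *ₚ (G *ₚ G)) ((suc d ℕ.+ M) ℕ.+ (suc d ℕ.+ M)) × Degree (F *ₚ F) ((suc d ℕ.+ M) ℕ.+ (suc d ℕ.+ M))
    Pell-square-Degree {D} {F} {G} {d} {M} dD pell dG = dDG² ,
      Degree-resp-≋ (≋-sym (Pell-square pell)) (+ₚ-Degree-lowerˡ (degree≤ oneₚ-Degree) (s≤s z≤n) dDG²)
      where
        dDG² = subst (Degree (D *ₚ (G *ₚ G))) (ℕ-+-interchange (suc d) (suc d) M M) (*ₚ-Degree dD (*ₚ-Degree dG dG))

  Pell-Degree : ∀ {D F G d} → Degree D (suc d ℕ.+ suc d) → Pell D F G → ¬ G ≋ [] → ∃ (Degree F)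
  Pell-Degree {F = F} dD pell G≉0 = ≉[]⇒Degree λ F≋0 →
    Degree⇒≉[] (proj₂ (Pell-square-Degree dD pell (proj₂ (≉[]⇒Degree G≉0)))) (*ₚ-zeroˡ F F≋0)

  Pell-nontrivial : ∀ {D F G d N} → Degree D (suc d ℕ.+ suc d) → Pell D F G → ¬ G ≋ [] → Degree F N →
    1 ≤ N × Degree (D *ₚ (G *ₚ G)) (N ℕ.+ N) × coeff (D *ₚ (G *ₚ G)) (N ℕ.+ N) ≡ coeff F N * coeff F N
  Pell-nontrivial {D} {F} {G} {d} {N} dD pell G≉0 dF =
    subst (1 ≤_) (sym N≡K) (s≤s z≤n) , subst (λ k → Degree DG² (k ℕ.+ k)) (sym N≡K) dDG² , lc
    where
      DG² = D *ₚ (G *ₚ G)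
      M = proj₁ (≉[]⇒Degree G≉0)
      dG = proj₂ (≉[]⇒Degree G≉0)
      K = suc d ℕ.+ M
      dDG² : Degree DG² (K ℕ.+ K)
      dDG² = proj₁ (Pell-square-Degree dD pell dG)
      N≡K : N ≡ K
      N≡K = m+m≡n+n⇒m≡n (Degree-unique (*ₚ-Degree dF dF) (proj₂ (Pell-square-Degree dD pell dG)))
      lc : coeff DG² (N ℕ.+ N) ≡ coeff F N * coeff F N
      lc = begin
        coeff DG² (N ℕ.+ N)             ≡⟨ coeff-+ₚ-lowerˡ {q = DG²} (degree≤ oneₚ-Degree) (subst (λ k → 0 < k ℕ.+ k) (sym N≡K) (s≤s z≤n)) ⟨
        coeff (oneₚ +ₚ DG²) (N ℕ.+ N)   ≡⟨ coeff-≡ (Pell-square pell) (N ℕ.+ N) ⟨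
        coeff (F *ₚ F) (N ℕ.+ N)        ≡⟨ coeff-*ₚ-top (degree≤ dF) (degree≤ dF) ⟩
        coeff F N * coeff F N           ∎
        where open ≡-Reasoning

  module _ (u : A) where

    private
      ℓ : Pol
      ℓ = u ∷ 1# ∷ []

      ℓ-Degree≤ : Degree≤ ℓ 1
      ℓ-Degree≤ = Degree≤-∷ [ 1# ]ₚ-Degree≤

      compose-tail≋[] : ∀ {a p} → Degree≤ (a ∷ p) 0 → ℓ *ₚ compose p ℓ ≋ []
      compose-tail≋[] dp = ≋-trans (*ₚ-congˡ ℓ (compose-zero ℓ (Degree≤0⇒tail≋[] dp))) (*ₚ-zeroʳ ℓ)

    compose-linear-Degree≤ : ∀ {p n} → Degree≤ p n → Degree≤ (compose p ℓ) n
    compose-linear-Degree≤ {[]}    _  = []-Degree≤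
    compose-linear-Degree≤ {a ∷ p} {zero} dp =
      +ₚ-Degree≤ [ a ]ₚ-Degree≤ (Degree≤-resp-≋ (≋-sym (compose-tail≋[] dp)) []-Degree≤)
    compose-linear-Degree≤ {a ∷ p} {suc n} dp =
      +ₚ-Degree≤ (Degree≤-mono [ a ]ₚ-Degree≤ z≤n) (*ₚ-Degree≤ ℓ-Degree≤ (compose-linear-Degree≤ (Degree≤-tail dp)))

    coeff-compose-linear : ∀ {p n} → Degree≤ p n → coeff (compose p ℓ) n ≡ coeff p n
    coeff-compose-linear {[]}    _ = refl
    coeff-compose-linear {a ∷ p} {zero} dp =
      trans (coeff-+ₚ [ a ]ₚ (ℓ *ₚ compose p ℓ) 0) (trans (cong (a +_) (coeff-≡ (compose-tail≋[] dp) 0)) (R.+-identityʳ a))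
    coeff-compose-linear {a ∷ p} {suc n} dp = begin
      coeff ([ a ]ₚ +ₚ ℓ *ₚ compose p ℓ) (suc n) ≡⟨ coeff-+ₚ-lowerˡ {q = ℓ *ₚ compose p ℓ} [ a ]ₚ-Degree≤ (s≤s z≤n) ⟩
      coeff (ℓ *ₚ compose p ℓ) (1 ℕ.+ n)         ≡⟨ coeff-*ₚ-top ℓ-Degree≤ (compose-linear-Degree≤ (Degree≤-tail dp)) ⟩
      1# * coeff (compose p ℓ) n                 ≡⟨ R.*-identityˡ _ ⟩
      coeff (compose p ℓ) n                      ≡⟨ coeff-compose-linear (Degree≤-tail dp) ⟩
      coeff p n                                  ∎
      where open ≡-Reasoning

    compose-linear-Degree : ∀ {p n} → Degree p n → Degree (compose p ℓ) n
    compose-linear-Degree (mkDegree lc≢0 dp) =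
      mkDegree (λ lc≡0 → lc≢0 (trans (sym (coeff-compose-linear dp)) lc≡0)) (compose-linear-Degree≤ dp)

ℚ-*-cancelˡ : ∀ {z x y} → z ≢ 0ℚ → z ℚ.* x ≡ z ℚ.* y → x ≡ y
ℚ-*-cancelˡ {z} {x} {y} z≢0 zx≡zy = begin
  x                     ≡⟨ ℚP.*-identityˡ x ⟨
  1ℚ ℚ.* x              ≡⟨ cong (ℚ._* x) (ℚP.*-inverseˡ z) ⟨
  ℚ.1/ z ℚ.* z ℚ.* x    ≡⟨ ℚP.*-assoc (ℚ.1/ z) z x ⟩
  ℚ.1/ z ℚ.* (z ℚ.* x)  ≡⟨ cong (ℚ.1/ z ℚ.*_) zx≡zy ⟩
  ℚ.1/ z ℚ.* (z ℚ.* y)  ≡⟨ ℚP.*-assoc (ℚ.1/ z) z y ⟨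
  ℚ.1/ z ℚ.* z ℚ.* y    ≡⟨ cong (ℚ._* y) (ℚP.*-inverseˡ z) ⟩
  1ℚ ℚ.* y              ≡⟨ ℚP.*-identityˡ y ⟩
  y                     ∎
  where
    open ≡-Reasoning
    instance _ = ℚ.≢-nonZero z≢0

ℚ-*-nonZero : ∀ {x y} → x ≢ 0ℚ → y ≢ 0ℚ → x ℚ.* y ≢ 0ℚ
ℚ-*-nonZero {x} x≢0 y≢0 xy≡0 = y≢0 (ℚ-*-cancelˡ x≢0 (trans xy≡0 (sym (ℚP.*-zeroʳ x))))

open PolynomialRing ℚP.+-*-isCommutativeRing
open PolynomialDegree ℚP.+-*-isCommutativeRing ℚP._≟_ (λ ()) ℚ-*-nonZero

2ℚ 4ℚ : ℚ
2ℚ = ι (ℤ.+ 2)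
4ℚ = ι (ℤ.+ 4)

ι≃mkℚᵘ : ∀ z → toℚᵘ (ι z) ℚᵘ.≃ mkℚᵘ z 0
ι≃mkℚᵘ z = ℚP.toℚᵘ-fromℚᵘ (mkℚᵘ z 0)

ι-+ : ∀ a b → ι (a ℤ.+ b) ≡ ι a ℚ.+ ι b
ι-+ a b = ℚP.toℚᵘ-injective (begin
  toℚᵘ (ι (a ℤ.+ b))                ≈⟨ ι≃mkℚᵘ (a ℤ.+ b) ⟩
  mkℚᵘ (a ℤ.+ b) 0                  ≈⟨ *≡* (cong (ℤ._* ℤ.+ 1) (cong₂ ℤ._+_ (ℤP.*-identityʳ a) (ℤP.*-identityʳ b))) ⟨
  mkℚᵘ a 0 ℚᵘ.+ mkℚᵘ b 0            ≈⟨ ℚᵘP.+-cong (ι≃mkℚᵘ a) (ι≃mkℚᵘ b) ⟨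
  toℚᵘ (ι a) ℚᵘ.+ toℚᵘ (ι b)        ≈⟨ ℚP.toℚᵘ-homo-+ (ι a) (ι b) ⟨
  toℚᵘ (ι a ℚ.+ ι b)                ∎)
  where open ℚᵘP.≃-Reasoning

ι-* : ∀ a b → ι (a ℤ.* b) ≡ ι a ℚ.* ι b
ι-* a b = ℚP.toℚᵘ-injective (begin
  toℚᵘ (ι (a ℤ.* b))                ≈⟨ ι≃mkℚᵘ (a ℤ.* b) ⟩
  mkℚᵘ a 0 ℚᵘ.* mkℚᵘ b 0            ≈⟨ ℚᵘP.*-cong (ι≃mkℚᵘ a) (ι≃mkℚᵘ b) ⟨
  toℚᵘ (ι a) ℚᵘ.* toℚᵘ (ι b)        ≈⟨ ℚP.toℚᵘ-homo-* (ι a) (ι b) ⟨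
  toℚᵘ (ι a ℚ.* ι b)                ∎)
  where open ℚᵘP.≃-Reasoning

ι-neg : ∀ a → ι (ℤ.- a) ≡ ℚ.- ι a
ι-neg a = ℚP.toℚᵘ-injective (begin
  toℚᵘ (ι (ℤ.- a))    ≈⟨ ι≃mkℚᵘ (ℤ.- a) ⟩
  ℚᵘ.- mkℚᵘ a 0       ≈⟨ ℚᵘP.-‿cong (ι≃mkℚᵘ a) ⟨
  ℚᵘ.- toℚᵘ (ι a)     ≈⟨ ℚP.toℚᵘ-homo‿- (ι a) ⟨
  toℚᵘ (ℚ.- ι a)      ∎)
  where open ℚᵘP.≃-Reasoning

ι-injective : ∀ {a b} → ι a ≡ ι b → a ≡ b
ι-injective {a} {b} ιa≡ιb
  with ℚᵘP.≃-trans (ℚᵘP.≃-sym (ι≃mkℚᵘ a)) (ℚᵘP.≃-trans (ℚᵘP.≃-reflexive (cong toℚᵘ ιa≡ιb)) (ι≃mkℚᵘ b))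
... | *≡* a*1≡b*1 = trans (sym (ℤP.*-identityʳ a)) (trans a*1≡b*1 (ℤP.*-identityʳ b))

toℚ[x]-+ₚ : ∀ p q → toℚ[x] (p ℤ[x].+ₚ q) ≡ toℚ[x] p +ₚ toℚ[x] q
toℚ[x]-+ₚ []      q       = refl
toℚ[x]-+ₚ (a ∷ p) []      = refl
toℚ[x]-+ₚ (a ∷ p) (b ∷ q) = cong₂ _∷_ (ι-+ a b) (toℚ[x]-+ₚ p q)

toℚ[x]-negₚ : ∀ p → toℚ[x] (ℤ[x].negₚ p) ≡ negₚ (toℚ[x] p)
toℚ[x]-negₚ []      = refl
toℚ[x]-negₚ (a ∷ p) = cong₂ _∷_ (ι-neg a) (toℚ[x]-negₚ p)

toℚ[x]-scale : ∀ a q → toℚ[x] (map (a ℤ.*_) q) ≡ map (ι a ℚ.*_) (toℚ[x] q)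
toℚ[x]-scale a []      = refl
toℚ[x]-scale a (b ∷ q) = cong₂ _∷_ (ι-* a b) (toℚ[x]-scale a q)

toℚ[x]-*ₚ : ∀ p q → toℚ[x] (p ℤ[x].*ₚ q) ≡ toℚ[x] p *ₚ toℚ[x] q
toℚ[x]-*ₚ []      q = refl
toℚ[x]-*ₚ (a ∷ p) q = trans (toℚ[x]-+ₚ (map (a ℤ.*_) q) (ℤ.+ 0 ∷ (p ℤ[x].*ₚ q)))
  (cong₂ _+ₚ_ (toℚ[x]-scale a q) (cong (0ℚ ∷_) (toℚ[x]-*ₚ p q)))

coeff-toℚ[x] : ∀ p n → coeff (toℚ[x] p) n ≡ ι (ℤ[x].coeff p n)
coeff-toℚ[x] []      n       = refl
coeff-toℚ[x] (a ∷ p) zero    = refl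
coeff-toℚ[x] (a ∷ p) (suc n) = coeff-toℚ[x] p n

toℚ[x]-≋[] : ∀ {p} → toℚ[x] p ≋ [] → ℤ[x].IsZero p
toℚ[x]-≋[] {p} (mk≋ e) n = ι-injective (trans (sym (coeff-toℚ[x] p n)) (e n))

toℚ[x]-Pell : ∀ {d F G} → ℤ[x].PellSol d F G → Pell (toℚ[x] d) (toℚ[x] F) (toℚ[x] G)
toℚ[x]-Pell {d} {F} {G} e = mkPell (mk≋ λ n → begin
  coeff (F′ *ₚ F′ -ₚ d′ *ₚ (G′ *ₚ G′)) n ≡⟨ cong (λ p → coeff p n) toℚ[x]-pell ⟨
  coeff (toℚ[x] pellℤ) n                 ≡⟨ coeff-toℚ[x] pellℤ n ⟩
  ι (ℤ[x].coeff pellℤ n)                 ≡⟨ cong ι (e n) ⟩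
  ι (ℤ[x].coeff ℤ[x].oneₚ n)             ≡⟨ coeff-toℚ[x] ℤ[x].oneₚ n ⟨
  coeff oneₚ n                           ∎)
  where
    open ≡-Reasoning
    F′ = toℚ[x] F
    G′ = toℚ[x] G
    d′ = toℚ[x] d
    pellℤ = F ℤ[x].*ₚ F ℤ[x].-ₚ d ℤ[x].*ₚ (G ℤ[x].*ₚ G)
    toℚ[x]-pell : toℚ[x] pellℤ ≡ F′ *ₚ F′ -ₚ d′ *ₚ (G′ *ₚ G′)
    toℚ[x]-pell = begin
      toℚ[x] pellℤ                                                  ≡⟨ toℚ[x]-+ₚ (F ℤ[x].*ₚ F) _ ⟩
      toℚ[x] (F ℤ[x].*ₚ F) +ₚ toℚ[x] (ℤ[x].negₚ (d ℤ[x].*ₚ (G ℤ[x].*ₚ G))) ≡⟨ cong₂ _+ₚ_ (toℚ[x]-*ₚ F F) (toℚ[x]-negₚ _) ⟩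
      F′ *ₚ F′ -ₚ toℚ[x] (d ℤ[x].*ₚ (G ℤ[x].*ₚ G))                   ≡⟨ cong (λ p → F′ *ₚ F′ -ₚ p) (toℚ[x]-*ₚ d _) ⟩
      F′ *ₚ F′ -ₚ d′ *ₚ toℚ[x] (G ℤ[x].*ₚ G)                         ≡⟨ cong (λ p → F′ *ₚ F′ -ₚ d′ *ₚ p) (toℚ[x]-*ₚ G G) ⟩
      F′ *ₚ F′ -ₚ d′ *ₚ (G′ *ₚ G′)                                   ∎

ℤ⟶ℚ[x] : ℤ.+-*-rawRing -Raw-AlmostCommutative⟶ fromCommutativeRing commutativeRing
ℤ⟶ℚ[x] = record
  { ⟦_⟧    = λ z → [ ι z ]ₚ
  ; +-homo = λ a b → ∷-cong (ι-+ a b) ≋-refl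
  ; *-homo = λ a b → ∷-cong (trans (ι-* a b) (sym (ℚP.+-identityʳ _))) ≋-refl
  ; -‿homo = λ a → ∷-cong (ι-neg a) ≋-refl
  ; 0-homo = 0∷≋ ≋-refl
  ; 1-homo = ≋-refl
  }

ℤ⟶ℚ[x]-≟ : ∀ a b → Maybe ([ ι a ]ₚ ≋ [ ι b ]ₚ)
ℤ⟶ℚ[x]-≟ a b with a ℤ.≟ b
... | yes refl = just ≋-refl
... | no  _    = nothing

module ℚ[x]-Solver = RingSolver ℤ.+-*-rawRing (fromCommutativeRing commutativeRing) ℤ⟶ℚ[x] ℤ⟶ℚ[x]-≟

brahmagupta-identity⁺ : ∀ D F G f g →
  (F *ₚ f +ₚ D *ₚ (G *ₚ g)) *ₚ (F *ₚ f +ₚ D *ₚ (G *ₚ g)) -ₚ D *ₚ ((G *ₚ f +ₚ F *ₚ g) *ₚ (G *ₚ f +ₚ F *ₚ g))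
    ≋ (F *ₚ F -ₚ D *ₚ (G *ₚ G)) *ₚ (f *ₚ f -ₚ D *ₚ (g *ₚ g))
brahmagupta-identity⁺ = solve 5 (λ D F G f g →
  (F :* f :+ D :* (G :* g)) :* (F :* f :+ D :* (G :* g)) :- D :* ((G :* f :+ F :* g) :* (G :* f :+ F :* g))
    := (F :* F :- D :* (G :* G)) :* (f :* f :- D :* (g :* g))) ≋-refl
  where open ℚ[x]-Solver

brahmagupta-identity⁻ : ∀ D F G f g →
  (F *ₚ f -ₚ D *ₚ (G *ₚ g)) *ₚ (F *ₚ f -ₚ D *ₚ (G *ₚ g)) -ₚ D *ₚ ((G *ₚ f -ₚ F *ₚ g) *ₚ (G *ₚ f -ₚ F *ₚ g))
    ≋ (F *ₚ F -ₚ D *ₚ (G *ₚ G)) *ₚ (f *ₚ f -ₚ D *ₚ (g *ₚ g))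
brahmagupta-identity⁻ = solve 5 (λ D F G f g →
  (F :* f :- D :* (G :* g)) :* (F :* f :- D :* (G :* g)) :- D :* ((G :* f :- F :* g) :* (G :* f :- F :* g))
    := (F :* F :- D :* (G :* G)) :* (f :* f :- D :* (g :* g))) ≋-refl
  where open ℚ[x]-Solver

conjugate-product-identity : ∀ D F G f g →
  (F *ₚ f -ₚ D *ₚ (G *ₚ g)) *ₚ (F *ₚ f +ₚ D *ₚ (G *ₚ g))
    ≋ (F *ₚ F -ₚ D *ₚ (G *ₚ G)) *ₚ (f *ₚ f) +ₚ D *ₚ (G *ₚ G) *ₚ (f *ₚ f -ₚ D *ₚ (g *ₚ g))
conjugate-product-identity = solve 5 (λ D F G f g →
  (F :* f :- D :* (G :* g)) :* (F :* f :+ D :* (G :* g))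
    := (F :* F :- D :* (G :* G)) :* (f :* f) :+ D :* (G :* G) :* (f :* f :- D :* (g :* g))) ≋-refl
  where open ℚ[x]-Solver

conjugate-sum-identity : ∀ D F G f g →
  (F *ₚ f -ₚ D *ₚ (G *ₚ g)) +ₚ (F *ₚ f +ₚ D *ₚ (G *ₚ g)) ≋ [ 2ℚ ]ₚ *ₚ (F *ₚ f)
conjugate-sum-identity = solve 5 (λ D F G f g →
  (F :* f :- D :* (G :* g)) :+ (F :* f :+ D :* (G :* g)) := con (ℤ.+ 2) :* (F :* f)) ≋-refl
  where open ℚ[x]-Solver

Pell-brahmagupta⁺ : ∀ {D F G f g} → Pell D F G → Pell D f g →
                    Pell D (F *ₚ f +ₚ D *ₚ (G *ₚ g)) (G *ₚ f +ₚ F *ₚ g)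
Pell-brahmagupta⁺ {D} {F} {G} {f} {g} (mkPell e) (mkPell e′) =
  mkPell (≋-trans (brahmagupta-identity⁺ D F G f g) (≋-trans (*ₚ-cong e e′) (*ₚ-identityˡ oneₚ)))

Pell-brahmagupta⁻ : ∀ {D F G f g} → Pell D F G → Pell D f g →
                    Pell D (F *ₚ f -ₚ D *ₚ (G *ₚ g)) (G *ₚ f -ₚ F *ₚ g)
Pell-brahmagupta⁻ {D} {F} {G} {f} {g} (mkPell e) (mkPell e′) =
  mkPell (≋-trans (brahmagupta-identity⁻ D F G f g) (≋-trans (*ₚ-cong e e′) (*ₚ-identityˡ oneₚ)))

Pell-conjugate-product : ∀ {D F G f g} → Pell D F G → Pell D f g →
  (F *ₚ f -ₚ D *ₚ (G *ₚ g)) *ₚ (F *ₚ f +ₚ D *ₚ (G *ₚ g)) ≋ f *ₚ f +ₚ D *ₚ (G *ₚ G)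
Pell-conjugate-product {D} {F} {G} {f} {g} (mkPell e) (mkPell e′) =
  ≋-trans (conjugate-product-identity D F G f g)
    (+ₚ-cong (≋-trans (*ₚ-congʳ (f *ₚ f) e) (*ₚ-identityˡ (f *ₚ f)))
             (≋-trans (*ₚ-congˡ (D *ₚ (G *ₚ G)) e′) (*ₚ-identityʳ (D *ₚ (G *ₚ G)))))

ℚ-square≡0 : ∀ {x} → x ℚ.* x ≡ 0ℚ → x ≡ 0ℚ
ℚ-square≡0 {x} x²≡0 with x ℚP.≟ 0ℚ
... | yes x≡0 = x≡0
... | no  x≢0 = ⊥-elim (ℚ-*-nonZero x≢0 x≢0 x²≡0)

ℚ-square-positive : ∀ {x} → x ≢ 0ℚ → 0ℚ ℚ.< x ℚ.* x
ℚ-square-positive {x} x≢0 with ℚP.<-cmp x 0ℚ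
... | tri< x<0 _ _ = ℚP.positive⁻¹ _ {{ℚP.neg*neg⇒pos x {{ℚ.negative x<0}} x {{ℚ.negative x<0}}}}
... | tri≈ _ x≡0 _ = ⊥-elim (x≢0 x≡0)
... | tri> _ _ x>0 = ℚP.positive⁻¹ _ {{ℚP.pos*pos⇒pos x {{ℚ.positive x>0}} x {{ℚ.positive x>0}}}}

ℚ-square-nonNegative : ∀ x → 0ℚ ℚ.≤ x ℚ.* x
ℚ-square-nonNegative x with x ℚP.≟ 0ℚ
... | yes refl = ℚP.≤-refl
... | no  x≢0  = ℚP.<⇒≤ (ℚ-square-positive x≢0)

ℚ-sum-of-squares≢0 : ∀ {x} y → x ≢ 0ℚ → x ℚ.* x ℚ.+ y ℚ.* y ≢ 0ℚ
ℚ-sum-of-squares≢0 {x} y x≢0 =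
  ≢-sym (ℚP.<⇒≢ (ℚP.+-mono-<-≤ (ℚ-square-positive x≢0) (ℚ-square-nonNegative y)))

-- With e² = 1, the hypothesis says exactly that (c − e L)² = c² + L² − 2 e L c vanishes.
e²≡1⇒L²≡c² : ∀ {e L c} → e ℚ.* e ≡ 1ℚ → e ℚ.* (2ℚ ℚ.* (L ℚ.* c)) ≡ c ℚ.* c ℚ.+ L ℚ.* L →
             L ℚ.* L ≡ c ℚ.* c
e²≡1⇒L²≡c² {e} {L} {c} e²≡1 balance = begin
  L ℚ.* L                   ≡⟨ ℚP.*-identityˡ (L ℚ.* L) ⟨
  1ℚ ℚ.* (L ℚ.* L)          ≡⟨ cong (ℚ._* (L ℚ.* L)) e²≡1 ⟨
  e ℚ.* e ℚ.* (L ℚ.* L)     ≡⟨ solve 2 (λ e L → e :* e :* (L :* L) := (e :* L) :* (e :* L)) refl e L ⟩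
  (e ℚ.* L) ℚ.* (e ℚ.* L)   ≡⟨ cong (λ x → x ℚ.* x) c≡eL ⟨
  c ℚ.* c                   ∎
  where
    open ≡-Reasoning
    open +-*-Solver
    δ : ℚ
    δ = c ℚ.- e ℚ.* L
    δ²≡0 : δ ℚ.* δ ≡ 0ℚ
    δ²≡0 = begin
      δ ℚ.* δ
        ≡⟨ solve 3 (λ e L c → (c :- e :* L) :* (c :- e :* L)
                 := (c :* c :+ L :* L :- e :* (con 2ℚ :* (L :* c))) :+ (e :* e :- con 1ℚ) :* (L :* L)) refl e L c ⟩
      (c ℚ.* c ℚ.+ L ℚ.* L ℚ.- e ℚ.* (2ℚ ℚ.* (L ℚ.* c))) ℚ.+ (e ℚ.* e ℚ.- 1ℚ) ℚ.* (L ℚ.* L)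
        ≡⟨ cong₂ (λ x y → (c ℚ.* c ℚ.+ L ℚ.* L ℚ.- x) ℚ.+ (y ℚ.- 1ℚ) ℚ.* (L ℚ.* L)) balance e²≡1 ⟩
      (c ℚ.* c ℚ.+ L ℚ.* L ℚ.- (c ℚ.* c ℚ.+ L ℚ.* L)) ℚ.+ (1ℚ ℚ.- 1ℚ) ℚ.* (L ℚ.* L)
        ≡⟨ solve 2 (λ s t → (s :- s) :+ (con 1ℚ :- con 1ℚ) :* t := con 0ℚ) refl (c ℚ.* c ℚ.+ L ℚ.* L) (L ℚ.* L) ⟩
      0ℚ ∎
    c≡eL : c ≡ e ℚ.* L
    c≡eL = begin
      c                     ≡⟨ solve 3 (λ e L c → c := (c :- e :* L) :+ e :* L) refl e L c ⟩
      δ ℚ.+ e ℚ.* L         ≡⟨ cong (ℚ._+ e ℚ.* L) (ℚ-square≡0 {δ} δ²≡0) ⟩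
      0ℚ ℚ.+ e ℚ.* L        ≡⟨ ℚP.+-identityˡ (e ℚ.* L) ⟩
      e ℚ.* L               ∎

L≢0⇒L²≡4c²e² : ∀ {e L c} → L ≢ 0ℚ → e ℚ.* (2ℚ ℚ.* (L ℚ.* c)) ≡ L ℚ.* L →
                L ℚ.* L ≡ 4ℚ ℚ.* (c ℚ.* c) ℚ.* (e ℚ.* e)
L≢0⇒L²≡4c²e² {e} {L} {c} L≢0 balance = begin
  L ℚ.* L                                   ≡⟨ cong (λ x → x ℚ.* x) L≡2ec ⟩
  e ℚ.* (2ℚ ℚ.* c) ℚ.* (e ℚ.* (2ℚ ℚ.* c))   ≡⟨ solve 2 (λ e c → e :* (con 2ℚ :* c) :* (e :* (con 2ℚ :* c))
                                                            := con 4ℚ :* (c :* c) :* (e :* e)) refl e c ⟩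
  4ℚ ℚ.* (c ℚ.* c) ℚ.* (e ℚ.* e)            ∎
  where
    open ≡-Reasoning
    open +-*-Solver
    L≡2ec : L ≡ e ℚ.* (2ℚ ℚ.* c)
    L≡2ec = sym (ℚ-*-cancelˡ L≢0 (begin
      L ℚ.* (e ℚ.* (2ℚ ℚ.* c))   ≡⟨ solve 3 (λ L e c → L :* (e :* (con 2ℚ :* c)) := e :* (con 2ℚ :* (L :* c))) refl L e c ⟩
      e ℚ.* (2ℚ ℚ.* (L ℚ.* c))   ≡⟨ balance ⟩
      L ℚ.* L                    ∎))

module Descent
  {D f g : Pol} {d n : ℕ}
  (D-degree : Degree D (suc d ℕ.+ suc d))
  (f-pell : Pell D f g) (g≉0 : ¬ g ≋ []) (f-degree : Degree f n)
  (minimal : ∀ {F G m} → Pell D F G → ¬ G ≋ [] → Degree F m → n ≤ m) where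

  c : ℚ
  c = coeff f n

  LeadingSquare : ℚ → Set
  LeadingSquare L = ∃ λ k → L ℚ.* L ≡ 4ℚ ^ k ℚ.* (c ℚ.* c) ^ suc k

  n≥1 : 1 ≤ n
  n≥1 = proj₁ (Pell-nontrivial D-degree f-pell g≉0 f-degree)

  LeadingSquares : ℕ → Set
  LeadingSquares N = ∀ {F G} → Pell D F G → ¬ G ≋ [] → Degree F N → LeadingSquare (coeff F N)

  module Step {F G : Pol} {N : ℕ} (F-pell : Pell D F G) (G≉0 : ¬ G ≋ []) (F-degree : Degree F N) where

    L : ℚ
    L = coeff F N

    DG² P S : Pol
    DG² = D *ₚ (G *ₚ G)
    P   = f *ₚ f +ₚ DG²
    S   = [ 2ℚ ]ₚ *ₚ (F *ₚ f)

    N≥1 : 1 ≤ N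
    N≥1 = proj₁ (Pell-nontrivial D-degree F-pell G≉0 F-degree)

    DG²-degree : Degree DG² (N ℕ.+ N)
    DG²-degree = proj₁ (proj₂ (Pell-nontrivial D-degree F-pell G≉0 F-degree))

    DG²-leading : coeff DG² (N ℕ.+ N) ≡ L ℚ.* L
    DG²-leading = proj₂ (proj₂ (Pell-nontrivial D-degree F-pell G≉0 F-degree))

    f²-degree : Degree (f *ₚ f) (n ℕ.+ n)
    f²-degree = *ₚ-Degree f-degree f-degree

    f²-leading : coeff (f *ₚ f) (n ℕ.+ n) ≡ c ℚ.* c
    f²-leading = coeff-*ₚ-top (degree≤ f-degree) (degree≤ f-degree)

    two-degree : Degree [ 2ℚ ]ₚ 0
    two-degree = mkDegree (λ ()) [ 2ℚ ]ₚ-Degree≤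

    S-degree : Degree S (N ℕ.+ n)
    S-degree = *ₚ-Degree two-degree (*ₚ-Degree F-degree f-degree)

    S-leading : coeff S (N ℕ.+ n) ≡ 2ℚ ℚ.* (L ℚ.* c)
    S-leading = trans (coeff-*ₚ-top (degree≤ two-degree) (degree≤ (*ₚ-Degree F-degree f-degree)))
                      (cong (2ℚ ℚ.*_) (coeff-*ₚ-top (degree≤ F-degree) (degree≤ f-degree)))

    record Conjugate (p : ℕ) : Set where
      constructor conjugate
      field
        Z G′       : Pol
        a          : ℕ
        Z-pell     : Pell D Z G′
        Z-degree   : Degree Z a
        degree-sum : a ℕ.+ (N ℕ.+ n) ≡ p
        leading    : coeff Z a ℚ.* (2ℚ ℚ.* (L ℚ.* c)) ≡ coeff P p

    -- X = F f − D G g and Y = F f + D G g are solutions with X Y = P and X + Y = S.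
    lowerConjugate : ∀ {p} → Degree P p → p < (N ℕ.+ n) ℕ.+ (N ℕ.+ n) → Conjugate p
    lowerConjugate dP p<2s =
      fromFactor (lowerFactor (Pell-conjugate-product F-pell f-pell) (conjugate-sum-identity D F G f g) dP S-degree p<2s)
      where
        X = F *ₚ f -ₚ D *ₚ (G *ₚ g)
        Y = F *ₚ f +ₚ D *ₚ (G *ₚ g)
        fromFactor : ∃₂ (λ Z a → (Z ≡ X ⊎ Z ≡ Y) × Degree Z a × a ℕ.+ (N ℕ.+ n) ≡ _ × coeff Z a ℚ.* coeff S (N ℕ.+ n) ≡ coeff P _) → Conjugate _
        fromFactor (Z , a , inj₁ refl , dZ , a+s≡p , lc) =
          conjugate Z _ a (Pell-brahmagupta⁻ F-pell f-pell) dZ a+s≡p (trans (cong (coeff Z a ℚ.*_) (sym S-leading)) lc)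
        fromFactor (Z , a , inj₂ refl , dZ , a+s≡p , lc) =
          conjugate Z _ a (Pell-brahmagupta⁺ F-pell f-pell) dZ a+s≡p (trans (cong (coeff Z a ℚ.*_) (sym S-leading)) lc)

    2n<2[N+n] : n ℕ.+ n < (N ℕ.+ n) ℕ.+ (N ℕ.+ n)
    2n<2[N+n] = ℕP.+-mono-< (ℕP.m<n+m n N≥1) (ℕP.m<n+m n N≥1)

    trivial-degree : ∀ {Z G′ a} → Pell D Z G′ → G′ ≋ [] → Degree Z a → a ≡ 0
    trivial-degree Z-pell G′≋0 Z-degree =
      Degree-unique Z-degree (proj₁ (square≋oneₚ (Pell-trivial Z-pell G′≋0)))

    below-minimal : N < n → ⊥
    below-minimal N<n = [ trivial , nontrivial ]′ (≋[]⊎Degree G′)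
      where
        P-degree : Degree P (n ℕ.+ n)
        P-degree = +ₚ-Degree-lowerʳ (degree≤ DG²-degree) (ℕP.+-mono-< N<n N<n) f²-degree
        open Conjugate (lowerConjugate P-degree 2n<2[N+n])
        a+N≡n : a ℕ.+ N ≡ n
        a+N≡n = m+[n+o]≡o+o⇒m+n≡o a N n degree-sum
        trivial : G′ ≋ [] → ⊥
        trivial G′≋0 = ℕP.<-irrefl (trans (cong (ℕ._+ N) (sym (trivial-degree Z-pell G′≋0 Z-degree))) a+N≡n) N<n
        nontrivial : ∃ (Degree G′) → ⊥
        nontrivial (_ , dG′) =
          ℕP.<⇒≱ (ℕP.<-≤-trans (ℕP.m<m+n a N≥1) (ℕP.≤-reflexive a+N≡n)) (minimal Z-pell (Degree⇒≉[] dG′) Z-degree)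

    at-minimal : N ≡ n → L ℚ.* L ≡ c ℚ.* c
    at-minimal N≡n = [ trivial , nontrivial ]′ (≋[]⊎Degree G′)
      where
        2N≡2n : N ℕ.+ N ≡ n ℕ.+ n
        2N≡2n = cong₂ ℕ._+_ N≡n N≡n
        P-leading : coeff P (n ℕ.+ n) ≡ c ℚ.* c ℚ.+ L ℚ.* L
        P-leading = trans (coeff-+ₚ (f *ₚ f) DG² (n ℕ.+ n))
          (cong₂ ℚ._+_ f²-leading (trans (cong (coeff DG²) (sym 2N≡2n)) DG²-leading))
        P-degree : Degree P (n ℕ.+ n)
        P-degree = mkDegree
          (λ lc≡0 → ℚ-sum-of-squares≢0 L (leading≢0 f-degree) (trans (sym P-leading) lc≡0))
          (+ₚ-Degree≤ (degree≤ f²-degree) (subst (Degree≤ DG²) 2N≡2n (degree≤ DG²-degree)))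
        open Conjugate (lowerConjugate P-degree 2n<2[N+n])
        a≡0 : a ≡ 0
        a≡0 = ℕP.+-cancelʳ-≡ n a 0 (trans (cong (a ℕ.+_) (sym N≡n)) (m+[n+o]≡o+o⇒m+n≡o a N n degree-sum))
        trivial : G′ ≋ [] → L ℚ.* L ≡ c ℚ.* c
        trivial G′≋0 = e²≡1⇒L²≡c² {coeff Z 0} {L} {c}
          (proj₂ (square≋oneₚ {Z} (Pell-trivial Z-pell G′≋0)))
          (trans (subst (λ i → coeff Z i ℚ.* _ ≡ _) a≡0 leading) P-leading)
        nontrivial : ∃ (Degree G′) → L ℚ.* L ≡ c ℚ.* c
        nontrivial (_ , dG′) = ⊥-elim (ℕP.<-irrefl (sym a≡0)
          (proj₁ (Pell-nontrivial D-degree Z-pell (Degree⇒≉[] dG′) Z-degree)))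

    above-minimal : n < N → (∀ {M} → M < N → LeadingSquares M) → LeadingSquare L
    above-minimal n<N descent = [ trivial , nontrivial ]′ (≋[]⊎Degree G′)
      where
        f²<DG² : n ℕ.+ n < N ℕ.+ N
        f²<DG² = ℕP.+-mono-< n<N n<N
        P-degree : Degree P (N ℕ.+ N)
        P-degree = +ₚ-Degree-lowerˡ (degree≤ f²-degree) f²<DG² DG²-degree
        P-leading : coeff P (N ℕ.+ N) ≡ L ℚ.* L
        P-leading = trans (coeff-+ₚ-lowerˡ (degree≤ f²-degree) f²<DG²) DG²-leading
        2N<2[N+n] : N ℕ.+ N < (N ℕ.+ n) ℕ.+ (N ℕ.+ n)
        2N<2[N+n] = ℕP.+-mono-< (ℕP.m<m+n N n≥1) (ℕP.m<m+n N n≥1)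
        open Conjugate (lowerConjugate P-degree 2N<2[N+n])
        a+n≡N : a ℕ.+ n ≡ N
        a+n≡N = m+[n+o]≡n+n⇒m+o≡n a N n degree-sum
        e = coeff Z a
        trivial : G′ ≋ [] → LeadingSquare L
        trivial G′≋0 =
          ⊥-elim (ℕP.<-irrefl (trans (cong (ℕ._+ n) (sym (trivial-degree Z-pell G′≋0 Z-degree))) a+n≡N) n<N)
        nontrivial : ∃ (Degree G′) → LeadingSquare L
        nontrivial (_ , dG′) = suc k , (begin
          L ℚ.* L                                                ≡⟨ L≢0⇒L²≡4c²e² {e} {L} {c} (leading≢0 F-degree) (trans leading P-leading) ⟩
          4ℚ ℚ.* (c ℚ.* c) ℚ.* (e ℚ.* e)                  ≡⟨ cong (4ℚ ℚ.* (c ℚ.* c) ℚ.*_) e²≡ ⟩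
          4ℚ ℚ.* (c ℚ.* c) ℚ.* (4ℚ ^ k ℚ.* (c ℚ.* c) ^ suc k)
            ≡⟨ solve 4 (λ x y A B → x :* y :* (A :* B) := (x :* A) :* (y :* B)) refl 4ℚ (c ℚ.* c) (4ℚ ^ k) ((c ℚ.* c) ^ suc k) ⟩
          4ℚ ^ suc k ℚ.* (c ℚ.* c) ^ suc (suc k)          ∎)
          where
            open ≡-Reasoning
            open +-*-Solver
            e-square = descent (ℕP.<-≤-trans (ℕP.m<m+n a n≥1) (ℕP.≤-reflexive a+n≡N)) Z-pell (Degree⇒≉[] dG′) Z-degree
            k = proj₁ e-square
            e²≡ = proj₂ e-square

  leadingSquares : ∀ N → LeadingSquares N
  leadingSquares = <-rec LeadingSquares step
    where
      step : ∀ N → (∀ {M} → M < N → LeadingSquares M) → LeadingSquares N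
      step N descent {F} F-pell G≉0 F-degree = byOrder (ℕP.<-cmp N n)
        where
          byOrder : Tri (N < n) (N ≡ n) (n < N) → LeadingSquare (coeff F N)
          byOrder (tri< N<n _ _) = ⊥-elim (Step.below-minimal F-pell G≉0 F-degree N<n)
          byOrder (tri≈ _ N≡n _) = 0 , trans (Step.at-minimal F-pell G≉0 F-degree N≡n)
                                              (sym (trans (ℚP.*-identityˡ _) (ℚP.*-identityʳ _)))
          byOrder (tri> _ _ n<N) = Step.above-minimal F-pell G≉0 F-degree n<N descent

coprime-*ˡ : ∀ {a b c} → Coprime a c → Coprime b c → Coprime (a ℕ.* b) c
coprime-*ˡ {a} {b} a⊥c b⊥c (i∣ab , i∣c) = b⊥c (coprime-divisor i⊥a i∣ab , i∣c)
  where
    i⊥a : Coprime _ a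
    i⊥a (j∣i , j∣a) = a⊥c (j∣a , ∣-trans j∣i i∣c)

coprime-^ˡ : ∀ {a c} j → Coprime a c → Coprime (a ℕ.^ j) c
coprime-^ˡ zero    a⊥c (i∣1 , _) = ∣1⇒≡1 i∣1
coprime-^ˡ (suc j) a⊥c = coprime-*ˡ a⊥c (coprime-^ˡ j a⊥c)

coprime-divisor-^ : ∀ {a b} j {m} → Coprime a b → a ∣ b ℕ.^ j ℕ.* m → a ∣ m
coprime-divisor-^ {a} zero    {m} a⊥b a∣m = subst (a ∣_) (ℕP.+-identityʳ m) a∣m
coprime-divisor-^ {a} {b} (suc j) {m} a⊥b a∣bbʲm =
  coprime-divisor-^ j a⊥b (coprime-divisor a⊥b (subst (a ∣_) (ℕP.*-assoc b (b ℕ.^ j) m) a∣bbʲm))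

ι-^ : ∀ i k → ι (i ℤ.^ k) ≡ ι i ^ k
ι-^ i zero    = refl
ι-^ i (suc k) = trans (ι-* i (i ℤ.^ k)) (cong (ι i ℚ.*_) (ι-^ i k))

∣-^∣ : ∀ i k → ℤ.∣ i ℤ.^ k ∣ ≡ ℤ.∣ i ∣ ℕ.^ k
∣-^∣ i zero    = refl
∣-^∣ i (suc k) = trans (ℤP.abs-* i (i ℤ.^ k)) (cong (ℤ.∣ i ∣ ℕ.*_) (∣-^∣ i k))

*-denominator : ∀ c → c ℚ.* ι (ℤ.+ ℚ.↧ₙ c) ≡ ι (ℚ.↥ c)
*-denominator c@(ℚ.mkℚ p d-1 _) = ℚP.toℚᵘ-injective (begin
  toℚᵘ (c ℚ.* ι (ℤ.+ suc d-1))            ≈⟨ ℚP.toℚᵘ-homo-* c (ι (ℤ.+ suc d-1)) ⟩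
  mkℚᵘ p d-1 ℚᵘ.* toℚᵘ (ι (ℤ.+ suc d-1))  ≈⟨ ℚᵘP.*-cong (ℚᵘP.≃-refl {mkℚᵘ p d-1}) (ι≃mkℚᵘ (ℤ.+ suc d-1)) ⟩
  mkℚᵘ p d-1 ℚᵘ.* mkℚᵘ (ℤ.+ suc d-1) 0    ≈⟨ *≡* (trans (ℤP.*-identityʳ _) (cong (λ x → p ℤ.* ℤ.+ x) (sym (ℕP.*-identityʳ (suc d-1))))) ⟩
  mkℚᵘ p 0                                ≈⟨ ι≃mkℚᵘ p ⟨
  toℚᵘ (ι p)                              ∎)
  where open ℚᵘP.≃-Reasoning

↧ₙ≡1⇒≡ι↥ : ∀ c → ℚ.↧ₙ c ≡ 1 → c ≡ ι (ℚ.↥ c)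
↧ₙ≡1⇒≡ι↥ (ℚ.mkℚ p zero _) _ = ℚP.toℚᵘ-injective (ℚᵘP.≃-sym (ι≃mkℚᵘ p))

↥⊥↧ₙ : ∀ c → Coprime ℤ.∣ ℚ.↥ c ∣ (ℚ.↧ₙ c)
↥⊥↧ₙ (ℚ.mkℚ _ _ coprime) = Coprime.recompute coprime

-- Clearing denominators turns the hypothesis into m pʲ = w qʲ for c = p / q in lowest terms.
denominator-^-∣ : ∀ c j m w → ι m ℚ.* c ^ j ≡ ι w → ℚ.↧ₙ c ℕ.^ j ∣ ℤ.∣ m ∣
denominator-^-∣ c j m w mcʲ≡w = coprime-divisor-^ j qʲ⊥p (divides ℤ.∣ w ∣ (begin
  ℤ.∣ p ∣ ℕ.^ j ℕ.* ℤ.∣ m ∣        ≡⟨ ℕP.*-comm (ℤ.∣ p ∣ ℕ.^ j) ℤ.∣ m ∣ ⟩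
  ℤ.∣ m ∣ ℕ.* ℤ.∣ p ∣ ℕ.^ j        ≡⟨ cong (ℤ.∣ m ∣ ℕ.*_) (∣-^∣ p j) ⟨
  ℤ.∣ m ∣ ℕ.* ℤ.∣ p ℤ.^ j ∣        ≡⟨ ℤP.abs-* m (p ℤ.^ j) ⟨
  ℤ.∣ m ℤ.* p ℤ.^ j ∣              ≡⟨ cong ℤ.∣_∣ (ι-injective {m ℤ.* p ℤ.^ j} {w ℤ.* (ℤ.+ q) ℤ.^ j} ι[mpʲ]≡ι[wqʲ]) ⟩
  ℤ.∣ w ℤ.* (ℤ.+ q) ℤ.^ j ∣        ≡⟨ ℤP.abs-* w ((ℤ.+ q) ℤ.^ j) ⟩
  ℤ.∣ w ∣ ℕ.* ℤ.∣ (ℤ.+ q) ℤ.^ j ∣  ≡⟨ cong (ℤ.∣ w ∣ ℕ.*_) (∣-^∣ (ℤ.+ q) j) ⟩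
  ℤ.∣ w ∣ ℕ.* q ℕ.^ j              ∎))
  where
    p = ℚ.↥ c
    q = ℚ.↧ₙ c
    qʲ⊥p : Coprime (q ℕ.^ j) ℤ.∣ p ∣
    qʲ⊥p = coprime-^ˡ j (Coprime.sym (↥⊥↧ₙ c))
    ι[mpʲ]≡ι[wqʲ] : ι (m ℤ.* p ℤ.^ j) ≡ ι (w ℤ.* (ℤ.+ q) ℤ.^ j)
    ι[mpʲ]≡ι[wqʲ] = begin
      ι (m ℤ.* p ℤ.^ j)                        ≡⟨ trans (ι-* m (p ℤ.^ j)) (cong (ι m ℚ.*_) (ι-^ p j)) ⟩
      ι m ℚ.* ι p ^ j                          ≡⟨ cong (λ x → ι m ℚ.* x ^ j) (*-denominator c) ⟨
      ι m ℚ.* (c ℚ.* ι (ℤ.+ q)) ^ j            ≡⟨ cong (ι m ℚ.*_) (^-distrib-* c (ι (ℤ.+ q)) j) ⟩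
      ι m ℚ.* (c ^ j ℚ.* ι (ℤ.+ q) ^ j)        ≡⟨ ℚP.*-assoc (ι m) (c ^ j) _ ⟨
      ι m ℚ.* c ^ j ℚ.* ι (ℤ.+ q) ^ j          ≡⟨ cong (ℚ._* ι (ℤ.+ q) ^ j) mcʲ≡w ⟩
      ι w ℚ.* ι (ℤ.+ q) ^ j                    ≡⟨ trans (ι-* w ((ℤ.+ q) ℤ.^ j)) (cong (ι w ℚ.*_) (ι-^ (ℤ.+ q) j)) ⟨
      ι (w ℤ.* (ℤ.+ q) ℤ.^ j)                  ∎
      where open ≡-Reasoning
    open ≡-Reasoning

q^[2+2k]∣4^k⇒q≤1 : ∀ q k → q ℕ.^ (suc k ℕ.+ suc k) ∣ 4 ℕ.^ k → q ≤ 1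
q^[2+2k]∣4^k⇒q≤1 q k q^[2+2k]∣4^k with ℕP.≤-<-connex q 1
... | inj₁ q≤1 = q≤1
... | inj₂ 1<q = ⊥-elim (ℕP.<-irrefl refl (begin-strict
  4 ℕ.^ k                   <⟨ ℕP.^-monoʳ-< 4 (s≤s (s≤s z≤n)) (ℕP.n<1+n k) ⟩
  4 ℕ.^ suc k               ≤⟨ ℕP.^-monoˡ-≤ (suc k) (ℕP.^-monoˡ-≤ 2 {2} {q} 1<q) ⟩
  (q ℕ.^ 2) ℕ.^ suc k       ≡⟨ ℕP.^-*-assoc q 2 (suc k) ⟩
  q ℕ.^ (2 ℕ.* suc k)       ≡⟨ cong (λ i → q ℕ.^ (suc k ℕ.+ i)) (ℕP.+-identityʳ (suc k)) ⟩
  q ℕ.^ (suc k ℕ.+ suc k)   ≤⟨ ∣⇒≤ {{ℕP.m^n≢0 4 k}} q^[2+2k]∣4^k ⟩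
  4 ℕ.^ k                   ∎))
  where open ℕP.≤-Reasoning

square⇒integral : ∀ c k z → ι z ℚ.* ι z ≡ 4ℚ ^ k ℚ.* (c ℚ.* c) ^ suc k → c ≡ ι (ℚ.↥ c)
square⇒integral c k z z²≡ = ↧ₙ≡1⇒≡ι↥ c (ℕP.≤-antisym (q^[2+2k]∣4^k⇒q≤1 (ℚ.↧ₙ c) k q²ʲ∣4ᵏ) (s≤s z≤n))
  where
    j = suc k
    4ᵏc²ʲ≡z² : ι ((ℤ.+ 4) ℤ.^ k) ℚ.* c ^ (j ℕ.+ j) ≡ ι (z ℤ.* z)
    4ᵏc²ʲ≡z² = begin
      ι ((ℤ.+ 4) ℤ.^ k) ℚ.* c ^ (j ℕ.+ j)   ≡⟨ cong₂ ℚ._*_ (ι-^ (ℤ.+ 4) k) (^-homo-* c j j) ⟩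
      4ℚ ^ k ℚ.* (c ^ j ℚ.* c ^ j)          ≡⟨ cong (4ℚ ^ k ℚ.*_) (^-distrib-* c c j) ⟨
      4ℚ ^ k ℚ.* (c ℚ.* c) ^ j              ≡⟨ z²≡ ⟨
      ι z ℚ.* ι z                           ≡⟨ ι-* z z ⟨
      ι (z ℤ.* z)                           ∎
      where open ≡-Reasoning
    q²ʲ∣4ᵏ : ℚ.↧ₙ c ℕ.^ (j ℕ.+ j) ∣ 4 ℕ.^ k
    q²ʲ∣4ᵏ = subst (ℚ.↧ₙ c ℕ.^ (j ℕ.+ j) ∣_) (∣-^∣ (ℤ.+ 4) k)
                   (denominator-^-∣ c (j ℕ.+ j) ((ℤ.+ 4) ℤ.^ k) (z ℤ.* z) 4ᵏc²ʲ≡z²)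

quartic-Degree : ∀ a₃ a₂ a₁ a₀ → Degree (toℚ[x] (quartic a₃ a₂ a₁ a₀)) 4
quartic-Degree _ _ _ _ = mkDegree (λ ()) (Degree≤-∷ (Degree≤-∷ (Degree≤-∷ (Degree≤-∷ [ 1ℚ ]ₚ-Degree≤))))

centered-Degree : ∀ a₃ a₂ a₁ a₀ → Degree (centered a₃ a₂ a₁ a₀) 4
centered-Degree a₃ a₂ a₁ a₀ = compose-linear-Degree (ℚ.- (a₃ ℚ./ 4)) (quartic-Degree a₃ a₂ a₁ a₀)

record IntegralLeadingSolution (D : Pol) : Set where
  field
    F G      : Pol
    N        : ℕ
    F-pell   : Pell D F G
    G≉0      : ¬ G ≋ []
    F-degree : Degree F N
    z        : ℤ
    leading  : coeff F N ≡ ι z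

Pellian⇒centered-solution : ∀ a₃ a₂ a₁ a₀ → Pellian (quartic a₃ a₂ a₁ a₀) →
                            IntegralLeadingSolution (centered a₃ a₂ a₁ a₀)
Pellian⇒centered-solution a₃ a₂ a₁ a₀ (_ , Fℤ , Gℤ , Gℤ≢0 , pellℤ) = record
  { F        = compose (toℚ[x] Fℤ) ℓ
  ; G        = compose (toℚ[x] Gℤ) ℓ
  ; N        = proj₁ Fℤ-degree
  ; F-pell   = F-pell
  ; G≉0      = G≉0
  ; F-degree = compose-linear-Degree u (proj₂ Fℤ-degree)
  ; z        = ℤ[x].coeff Fℤ (proj₁ Fℤ-degree)
  ; leading  = trans (coeff-compose-linear u (degree≤ (proj₂ Fℤ-degree))) (coeff-toℚ[x] Fℤ _)
  }
  where
    u : ℚ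
    u = ℚ.- (a₃ ℚ./ 4)
    ℓ : Pol
    ℓ = u ∷ 1ℚ ∷ []
    F-pell : Pell (centered a₃ a₂ a₁ a₀) (compose (toℚ[x] Fℤ) ℓ) (compose (toℚ[x] Gℤ) ℓ)
    F-pell = Pell-compose ℓ (toℚ[x]-Pell {quartic a₃ a₂ a₁ a₀} {Fℤ} {Gℤ} pellℤ)
    G≉0 : ¬ compose (toℚ[x] Gℤ) ℓ ≋ []
    G≉0 = Degree⇒≉[] (compose-linear-Degree u (proj₂ (≉[]⇒Degree (Gℤ≢0 ∘ toℚ[x]-≋[] {Gℤ}))))
    Fℤ-degree : ∃ (Degree (toℚ[x] Fℤ))
    Fℤ-degree = ≉[]⇒Degree λ Fℤ≋0 →
      Degree⇒≉[] (proj₂ (Pell-Degree {d = 1} (centered-Degree a₃ a₂ a₁ a₀) F-pell G≉0)) (compose-zero ℓ Fℤ≋0)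

proposition5p3 : (a₃ a₂ a₁ a₀ : ℤ)
    → SquareFree (quartic a₃ a₂ a₁ a₀)
    → Pellian (quartic a₃ a₂ a₁ a₀)
    → (f₁ g₁ : ℚPoly) → ¬ ℚ[x].IsZero g₁
    → ℚ[x].PellSol (centered a₃ a₂ a₁ a₀) f₁ g₁
    → (n : ℕ) → ℚ[x].HasDegree f₁ n
    → (∀ (f g : ℚPoly) (m : ℕ) → ¬ ℚ[x].IsZero g
         → ℚ[x].PellSol (centered a₃ a₂ a₁ a₀) f g
         → ℚ[x].HasDegree f m → n ≤ m)
    → ∃ λ (z : ℤ) → ℚ[x].coeff f₁ n ≡ ι z
proposition5p3 a₃ a₂ a₁ a₀ _ pellian f₁ g₁ g₁≢0 f₁-pell n f₁-degree minimal =
  ℚ.↥ c , square⇒integral c k z (trans (cong (λ x → x ℚ.* x) (sym leading)) F²≡)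
  where
    open IntegralLeadingSolution (Pellian⇒centered-solution a₃ a₂ a₁ a₀ pellian)
    open Descent {centered a₃ a₂ a₁ a₀} {f₁} {g₁} {1} {n} (centered-Degree a₃ a₂ a₁ a₀)
      (mkPell (mk≋ f₁-pell)) (g₁≢0 ∘ coeff-≡) (HasDegree⇒Degree f₁-degree)
      (λ {f} {g} {m} (mkPell (mk≋ f-pell)) g≉0 f-degree →
        minimal f g m (g≉0 ∘ mk≋) f-pell (Degree⇒HasDegree f-degree))
    k  = proj₁ (leadingSquares N F-pell G≉0 F-degree)
    F²≡ = proj₂ (leadingSquares N F-pell G≉0 F-degree)
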